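{- Let $p$ be a prime, $q=p^s$, $A=\mathbb{F}_q[t]$, $K=\mathbb{F}_q(t)$, $[1]=t^q-t$, and $a\in\mathbb{Z}_+$. Let $m$ be the smallest nonnegative integer with $a\le p^m$ and $r_a=(q-1)p^m$. For $0\le j\le p^m-a$ let $i_j$ be the unique integer with $0\le i_j<q-1$ and $j+i_jp^m\equiv 0\pmod{q-1}$, and let $f_{a,j}=(-1)^j\binom{p^m-a}{j}\in\mathbb{F}_p$. For each monic polynomial $n\in A$ of degree $1$ define $$g_n=-\frac{[1]^{p^m-a}}{n^{p^m-a}}\,[1]^a S_1(a).$$ Then $$g_n=1+\sum_{j=1}^{p^m-a}f_{a,j}\,n^{\,r_a-(j+i_jp^m)}.$$
   Context: For $s\in\mathbb{Z}$, $S_1(s)=\sum_{n}n^{ -s}\in K$, the sum over all monic polynomials $n\in A$ of degree $1$ (i.e. $n=t+\theta$, $\theta\in\mathbb{F}_q$). -}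

module Defs where

open import Level using (0ℓ)
open import Algebra.Bundles using (CommutativeRing)
open import Data.Nat using (ℕ; zero; suc)
open import Data.List using (List; []; _∷_; map)
open import Data.List.Relation.Unary.Any using (Any)
open import Data.List.Relation.Unary.AllPairs using (AllPairs)
open import Relation.Nullary using (¬_)

-- A field: a commutative ring (setoid equality) with 1 ≠ 0 and a total
-- function _⁻¹ which is a multiplicative inverse on nonzero elements
-- (its value at 0 is irrelevant and unconstrained).
record Field : Set₁ where
  field
    commRing : CommutativeRing 0ℓ 0ℓ
  open CommutativeRing commRing public
  field
    _⁻¹ : Carrier → Carrier
    1≉0 : ¬ (1# ≈ 0#)
    inverseʳ : ∀ x → ¬ (x ≈ 0#) → (x * (x ⁻¹)) ≈ 1#

module FieldOps (K : Field) where
  open Field K public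

  pow : Carrier → ℕ → Carrier
  pow x zero    = 1#
  pow x (suc n) = x * pow x n

  fromℕ : ℕ → Carrier
  fromℕ zero    = 0#
  fromℕ (suc n) = 1# + fromℕ n

  sumL : List Carrier → Carrier
  sumL []       = 0#
  sumL (x ∷ xs) = x + sumL xs

  Σ₁ : ℕ → (ℕ → Carrier) → Carrier
  Σ₁ zero    f = 0#
  Σ₁ (suc N) f = Σ₁ N f + f (suc N)

  eval : List Carrier → Carrier → Carrier
  eval []       x = 0#
  eval (c ∷ cs) x = c + x * eval cs x

-- es lists every element of F exactly once (up to the field's equality);
-- so F is finite with (length es) elements.
record Enumerates (F : Field) (es : List (Field.Carrier F)) : Set where
  open Field F
  field
    complete : ∀ x → Any (x ≈_) es
    distinct : AllPairs (λ x y → ¬ (x ≈ y)) es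

Transcendental : (F K : Field) → (Field.Carrier F → Field.Carrier K) → Field.Carrier K → Set
Transcendental F K ι t =
  ∀ (cs : List (Field.Carrier F)) →
    Any (λ c → ¬ (Field._≈_ F c (Field.0# F))) cs →
    ¬ (Field._≈_ K (FieldOps.eval K (map ι cs) t) (Field.0# K))

-- the field operations of K with the ring operations renamed, so that
-- they do not clash with the ℕ operations in the statement
module FieldOpsᴷ (K : Field) where
  open FieldOps K public renaming (_+_ to _+ᴷ_; _*_ to _*ᴷ_; _-_ to _-ᴷ_; -_ to -ᴷ_)

module Submission where

-- Proposition 5.10. Write q = p^s, N = p^m, e = N - a, r = (q-1)·N,
-- y_c = t + ι c for c ∈ 𝔽_q and n = t + ι θ. The proof has four steps.
--  1. In characteristic p, (t + c)^q = t^q + c, so [1] = y_c·(y_c^(q-1) - 1) and, by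
--     the Frobenius map, [1]^N / y_c^a = φ(y_c) with φ(y) = y^e (y^r - 1). Hence
--     [1]^N S₁(a) = Σ_c φ(y_c) = Σ_γ φ(n + ι γ), substituting c = θ + γ.
--  2. (n + z)^r = (n^N + z^N)^(q-1) is a geometric sum because (u + v)^q = u^q + v^q;
--     with the binomial theorem for (n + z)^e, φ(n + z) becomes a double sum of
--     multiples of z^(j + kN), plus (n + z)^e (z^r - 1).
--  3. Summing over z = ι γ produces the power sums P(l) = Σ_γ γ^l of 𝔽_q, which vanish
--     unless q - 1 ∣ l and equal -1 for positive multiples (Fermat and a root count):
--     only k = i_j survives, and the last term contributes -n^e (from γ = 0 alone).
--  4. So Σ_γ φ(n + ι γ) = -n^e (1 + Σ_j f_j n^(r - (j + i_j N))); divide by -n^e.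

open import Level using (0ℓ)
open import Algebra.Bundles using (CommutativeRing; CommutativeMonoid)
open import Relation.Binary.Bundles using (Setoid)
open import Data.List using (List)
open import Defs

-- Every commutative ring R receives the canonical map ℤ → R, and it is a
-- ring homomorphism. This lets us use the standard ring solver with
-- integer coefficients, which (unlike coefficients in R itself) can
-- decide when a coefficient such as 1 - 1 vanishes.
module IntegerSolver (R : CommutativeRing 0ℓ 0ℓ) where
  open import Algebra.Solver.Ring.AlmostCommutativeRing
    using (fromCommutativeRing; _-Raw-AlmostCommutative⟶_)
  open import Data.Nat as ℕ using (ℕ; zero; suc)
  import Data.Nat.Properties as ℕₚ
  open import Data.Integer as ℤ using (ℤ; +_; -[1+_]; _⊖_)
  import Data.Integer.Properties as ℤₚ
  open import Data.Sign as Sign using (Sign)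
  open import Data.Maybe using (Maybe; just; nothing)
  open import Relation.Nullary using (yes; no)
  import Relation.Binary.PropositionalEquality as ≡
  open CommutativeRing R public
  open import Relation.Binary.Reasoning.Setoid setoid public
  open import Algebra.Properties.Ring ring public
  open import Algebra.Properties.Semiring.Mult.TCOptimised semiring
    using (_×_; 1+×; ×-homo-+; ×1-homo-*)
  open import Algebra.Properties.CommutativeSemigroup *-commutativeSemigroup using (interchange)

  private
    ⟦_⟧ˢ : Sign → Carrier
    ⟦ Sign.+ ⟧ˢ = 1#
    ⟦ Sign.- ⟧ˢ = - 1#

    ⟦_⟧ℤ : ℤ → Carrier
    ⟦ + n ⟧ℤ      = n × 1#
    ⟦ -[1+ n ] ⟧ℤ = - (suc n × 1#)

    ⊖-homo : ∀ m n → ⟦ m ⊖ n ⟧ℤ ≈ m × 1# - n × 1#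
    ⊖-homo zero    zero    = sym (-‿inverseʳ 0#)
    ⊖-homo (suc m) zero    = sym (trans (+-congˡ -0#≈0#) (+-identityʳ _))
    ⊖-homo zero    (suc n) = sym (+-identityˡ _)
    ⊖-homo (suc m) (suc n) = begin
      ⟦ suc m ⊖ suc n ⟧ℤ             ≡⟨ ≡.cong ⟦_⟧ℤ (ℤₚ.[1+m]⊖[1+n]≡m⊖n m n) ⟩
      ⟦ m ⊖ n ⟧ℤ                     ≈⟨ ⊖-homo m n ⟩
      m × 1# - n × 1#                ≈⟨ cancel-1 (m × 1#) (n × 1#) ⟩
      (1# + m × 1#) - (1# + n × 1#)  ≈⟨ +-cong (1+× m 1#) (-‿cong (1+× n 1#)) ⟨
      suc m × 1# - suc n × 1#        ∎
      where
      cancel-1 : ∀ x y → x - y ≈ (1# + x) - (1# + y)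
      cancel-1 x y = begin
        x - y                ≈⟨ +-congʳ (+-identityˡ x) ⟨
        (0# + x) - y         ≈⟨ +-congʳ (+-congʳ (-‿inverseʳ 1#)) ⟨
        ((1# - 1#) + x) - y  ≈⟨ +-congʳ (+-assoc 1# (- 1#) x) ⟩
        (1# + (- 1# + x)) - y ≈⟨ +-congʳ (+-congˡ (+-comm (- 1#) x)) ⟩
        (1# + (x - 1#)) - y  ≈⟨ +-assoc 1# (x - 1#) (- y) ⟩
        1# + ((x - 1#) - y)  ≈⟨ +-congˡ (+-assoc x (- 1#) (- y)) ⟩
        1# + (x + (- 1# - y)) ≈⟨ +-congˡ (+-congˡ (-‿+-comm 1# y)) ⟩
        1# + (x - (1# + y))  ≈⟨ +-assoc 1# x (- (1# + y)) ⟨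
        (1# + x) - (1# + y)  ∎

    +-homo : ∀ i j → ⟦ i ℤ.+ j ⟧ℤ ≈ ⟦ i ⟧ℤ + ⟦ j ⟧ℤ
    +-homo (+ m)      (+ n)      = ×-homo-+ 1# m n
    +-homo (+ m)      -[1+ n ]   = ⊖-homo m (suc n)
    +-homo -[1+ m ]   (+ n)      = trans (⊖-homo n (suc m)) (+-comm _ _)
    +-homo -[1+ m ]   -[1+ n ]   = begin
      - (suc (suc (m ℕ.+ n)) × 1#)       ≡⟨ ≡.cong (λ k → - (suc k × 1#)) (ℕₚ.+-suc m n) ⟨
      - ((suc m ℕ.+ suc n) × 1#)         ≈⟨ -‿cong (×-homo-+ 1# (suc m) (suc n)) ⟩
      - (suc m × 1# + suc n × 1#)        ≈⟨ -‿+-comm _ _ ⟨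
      - (suc m × 1#) + - (suc n × 1#)    ∎

    -‿homo : ∀ i → ⟦ ℤ.- i ⟧ℤ ≈ - ⟦ i ⟧ℤ
    -‿homo (+ zero)  = sym -0#≈0#
    -‿homo (+ suc n) = refl
    -‿homo -[1+ n ]  = sym (-‿involutive _)

    ◃-homo : ∀ s n → ⟦ s ℤ.◃ n ⟧ℤ ≈ ⟦ s ⟧ˢ * (n × 1#)
    ◃-homo s       zero    = sym (zeroʳ _)
    ◃-homo Sign.+  (suc n) = sym (*-identityˡ _)
    ◃-homo Sign.-  (suc n) = sym (-1*x≈-x _)

    sign-homo : ∀ s t → ⟦ s Sign.* t ⟧ˢ ≈ ⟦ s ⟧ˢ * ⟦ t ⟧ˢ
    sign-homo Sign.+ t      = sym (*-identityˡ _)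
    sign-homo Sign.- Sign.+ = sym (*-identityʳ _)
    sign-homo Sign.- Sign.- = sym (trans (-1*x≈-x (- 1#)) (-‿involutive 1#))

    sign-abs : ∀ i → ⟦ i ⟧ℤ ≈ ⟦ ℤ.sign i ⟧ˢ * (ℤ.∣ i ∣ × 1#)
    sign-abs i = trans (reflexive (≡.cong ⟦_⟧ℤ (≡.sym (ℤₚ.◃-inverse i)))) (◃-homo (ℤ.sign i) ℤ.∣ i ∣)

    *-homo : ∀ i j → ⟦ i ℤ.* j ⟧ℤ ≈ ⟦ i ⟧ℤ * ⟦ j ⟧ℤ
    *-homo i j = begin
      ⟦ (s Sign.* t) ℤ.◃ (∣i∣ ℕ.* ∣j∣) ⟧ℤ               ≈⟨ ◃-homo (s Sign.* t) (∣i∣ ℕ.* ∣j∣) ⟩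
      ⟦ s Sign.* t ⟧ˢ * ((∣i∣ ℕ.* ∣j∣) × 1#)            ≈⟨ *-cong (sign-homo s t) (×1-homo-* ∣i∣ ∣j∣) ⟩
      (⟦ s ⟧ˢ * ⟦ t ⟧ˢ) * ((∣i∣ × 1#) * (∣j∣ × 1#))     ≈⟨ interchange _ _ _ _ ⟩
      (⟦ s ⟧ˢ * (∣i∣ × 1#)) * (⟦ t ⟧ˢ * (∣j∣ × 1#))     ≈⟨ *-cong (sign-abs i) (sign-abs j) ⟨
      ⟦ i ⟧ℤ * ⟦ j ⟧ℤ                                  ∎
      where
      s t : Sign
      s = ℤ.sign i
      t = ℤ.sign j
      ∣i∣ ∣j∣ : ℕ
      ∣i∣ = ℤ.∣ i ∣
      ∣j∣ = ℤ.∣ j ∣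

    ℤ⟶R : ℤ.+-*-rawRing -Raw-AlmostCommutative⟶ fromCommutativeRing R
    ℤ⟶R = record
      { ⟦_⟧    = ⟦_⟧ℤ
      ; +-homo = +-homo
      ; *-homo = *-homo
      ; -‿homo = -‿homo
      ; 0-homo = refl
      ; 1-homo = refl
      }

    -- the solver only needs to recognise equal integer coefficients
    coefficient-test : ∀ i j → Maybe (⟦ i ⟧ℤ ≈ ⟦ j ⟧ℤ)
    coefficient-test i j with i ℤ.≟ j
    ... | yes ≡.refl = just refl
    ... | no _       = nothing

  open import Algebra.Solver.Ring ℤ.+-*-rawRing (fromCommutativeRing R) ℤ⟶R coefficient-test public
    using (solve; _:=_; _:+_; _:*_; _:-_; :-_; con)

module NatFacts where
  open import Data.Nat
  open import Data.Nat.Properties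
  open import Data.Nat.Combinatorics using (_C_; nCk+nC[k+1]≡[n+1]C[k+1]; k>n⇒nCk≡0; nC1≡n)
  open import Data.Nat.Divisibility
  open import Data.Nat.Coprimality using (Coprime; coprime-divisor)
  open import Data.Nat.Primality using (Prime; euclidsLemma)
  open import Data.Nat.Tactic.RingSolver using (solve-∀)
  open import Data.Product using (_,_)
  open import Data.Sum using (inj₁; inj₂)
  open import Relation.Nullary using (contradiction)
  open import Relation.Binary.PropositionalEquality
  open ≡-Reasoning

  binomial-absorption : ∀ n k → suc k * (suc n C suc k) ≡ suc n * (n C k)
  binomial-absorption zero    zero    = refl
  binomial-absorption zero    (suc k) = begin
    suc (suc k) * (1 C suc (suc k)) ≡⟨ cong (suc (suc k) *_) (k>n⇒nCk≡0 {1} {suc (suc k)} (s≤s (s≤s z≤n))) ⟩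
    suc (suc k) * 0                 ≡⟨ *-zeroʳ (suc (suc k)) ⟩
    0                               ≡⟨ cong (1 *_) (k>n⇒nCk≡0 {0} {suc k} (s≤s z≤n)) ⟨
    1 * (0 C suc k)                 ∎
  binomial-absorption (suc n) zero    = trans (*-identityˡ _) (trans (nC1≡n (suc (suc n))) (sym (*-identityʳ _)))
  binomial-absorption (suc n) (suc k) = begin
    suc (suc k) * (suc m C suc (suc k)) ≡⟨ cong (suc (suc k) *_) (nCk+nC[k+1]≡[n+1]C[k+1] m (suc k)) ⟨
    suc (suc k) * (a + b)               ≡⟨ regroup₁ k a b ⟩
    (suc k * a + a) + suc (suc k) * b   ≡⟨ cong₂ (λ u v → (u + a) + v) (binomial-absorption n k) (binomial-absorption n (suc k)) ⟩
    (m * c + a) + m * d                 ≡⟨ regroup₂ m c d a ⟩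
    m * (c + d) + a                     ≡⟨ cong (λ u → m * u + a) (nCk+nC[k+1]≡[n+1]C[k+1] n k) ⟩
    m * a + a                           ≡⟨ +-comm (m * a) a ⟩
    suc m * a                           ∎
    where
    m a b c d : ℕ
    m = suc n
    a = m C suc k
    b = m C suc (suc k)
    c = n C k
    d = n C suc k
    regroup₁ : ∀ k a b → suc (suc k) * (a + b) ≡ (suc k * a + a) + suc (suc k) * b
    regroup₁ = solve-∀
    regroup₂ : ∀ m c d a → (m * c + a) + m * d ≡ m * (c + d) + a
    regroup₂ = solve-∀

  -- A prime p divides C(p,j) for 0 < j < p: this is why (x+y)^p = x^p + y^p
  -- in characteristic p.
  prime∣binomial : ∀ {p} → Prime p → ∀ j → 0 < j → j < p → p ∣ (p C j)
  prime∣binomial {suc n} pp (suc k) _ j<p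
    with euclidsLemma (suc k) (suc n C suc k) pp
           (divides (n C k) (trans (binomial-absorption n k) (*-comm (suc n) (n C k))))
  ... | inj₂ p∣C = p∣C
  ... | inj₁ p∣j = contradiction (∣⇒≤ p∣j) (<⇒≱ j<p)

  pred-power-coprime : ∀ p s → 1 ≤ s → 0 < p ^ s → Coprime (p ^ s ∸ 1) p
  pred-power-coprime p (suc s) _ ps>0 {d} (d∣Q , d∣p) = ∣1⇒≡1 (∣m+n∣m⇒∣n d∣Q+1 d∣Q)
    where
    d∣Q+1 : d ∣ (p ^ suc s ∸ 1) + 1
    d∣Q+1 = subst (d ∣_) (sym (trans (+-comm _ 1) (m+[n∸m]≡n ps>0))) (∣m⇒∣m*n (p ^ s) d∣p)

  coprime-divisor-^ : ∀ {Q p} → Coprime Q p → ∀ m x → Q ∣ x * p ^ m → Q ∣ x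
  coprime-divisor-^ cop zero    x Q∣ = subst (_ ∣_) (*-identityʳ x) Q∣
  coprime-divisor-^ {Q} {p} cop (suc m) x Q∣ =
    coprime-divisor-^ cop m x (coprime-divisor cop (subst (Q ∣_) (swap x p (p ^ m)) Q∣))
    where
    swap : ∀ x p y → x * (p * y) ≡ p * (x * y)
    swap = solve-∀

  ∣<⇒≡0 : ∀ {Q d} → Q ∣ d → d < Q → d ≡ 0
  ∣<⇒≡0 {d = zero}  _   _   = refl
  ∣<⇒≡0 {d = suc d} Q∣d d<Q = contradiction (∣⇒≤ Q∣d) (<⇒≱ d<Q)

  -- Uniqueness of i_j: if Q is coprime to p, there is at most one
  -- i < Q with Q ∣ j + i·p^m. First the case i ≤ k: then Q ∣ (k - i)·p^m.
  exponent-unique-≤ : ∀ {Q p} → Coprime Q p → ∀ m j {k i} → i ≤ k → k < Q →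
    Q ∣ j + k * p ^ m → Q ∣ j + i * p ^ m → k ≡ i
  exponent-unique-≤ {Q} {p} cop m j {k} {i} i≤k k<Q Q∣k Q∣i = ≤-antisym (m∸n≡0⇒m≤n k∸i≡0) i≤k
    where
    N : ℕ
    N = p ^ m
    split : (j + i * N) + (k ∸ i) * N ≡ j + k * N
    split = begin
      (j + i * N) + (k ∸ i) * N ≡⟨ +-assoc j _ _ ⟩
      j + (i * N + (k ∸ i) * N) ≡⟨ cong (j +_) (*-distribʳ-+ N i (k ∸ i)) ⟨
      j + (i + (k ∸ i)) * N     ≡⟨ cong (λ z → j + z * N) (m+[n∸m]≡n i≤k) ⟩
      j + k * N                 ∎
    k∸i≡0 : k ∸ i ≡ 0
    k∸i≡0 = ∣<⇒≡0 (coprime-divisor-^ cop m (k ∸ i) (∣m+n∣m⇒∣n (subst (Q ∣_) (sym split) Q∣k) Q∣i))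
                  (≤-<-trans (m∸n≤m k i) k<Q)

  exponent-unique : ∀ {Q p} → Coprime Q p → ∀ m j {k i} → k < Q → i < Q →
    Q ∣ j + k * p ^ m → Q ∣ j + i * p ^ m → k ≡ i
  exponent-unique cop m j {k} {i} k<Q i<Q Q∣k Q∣i with ≤-total i k
  ... | inj₁ i≤k = exponent-unique-≤ cop m j i≤k k<Q Q∣k Q∣i
  ... | inj₂ k≤i = sym (exponent-unique-≤ cop m j k≤i i<Q Q∣i Q∣k)

  -- The exponent bookkeeping behind the final formula:
  -- (e - j) + N·(Q - i) = e + (Q·N - (j + i·N))  whenever j ≤ e < N and i < Q.
  exponent-shift : ∀ e j N Q i → j ≤ e → e < N → i < Q →
    (e ∸ j) + N * (Q ∸ i) ≡ e + (Q * N ∸ (j + i * N))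
  exponent-shift e j N Q i j≤e e<N i<Q = begin
    (e ∸ j) + N * D                      ≡⟨ cong ((e ∸ j) +_) (*-comm N D) ⟩
    (e ∸ j) + D * N                      ≡⟨ cong ((e ∸ j) +_) (m+[n∸m]≡n j≤DN) ⟨
    (e ∸ j) + (j + (D * N ∸ j))          ≡⟨ +-assoc (e ∸ j) j _ ⟨
    (e ∸ j) + j + (D * N ∸ j)            ≡⟨ cong (_+ (D * N ∸ j)) (m∸n+n≡m j≤e) ⟩
    e + (D * N ∸ j)                      ≡⟨ cong (e +_) ([m+n]∸[m+o]≡n∸o (i * N) (D * N) j) ⟨
    e + ((i * N + D * N) ∸ (i * N + j))  ≡⟨ cong₂ (λ u v → e + (u ∸ v)) (sym (*-distribʳ-+ N i D)) (+-comm (i * N) j) ⟩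
    e + ((i + D) * N ∸ (j + i * N))      ≡⟨ cong (λ u → e + (u * N ∸ (j + i * N))) (m+[n∸m]≡n (<⇒≤ i<Q)) ⟩
    e + (Q * N ∸ (j + i * N))            ∎
    where
    D : ℕ
    D = Q ∸ i
    j≤DN : j ≤ D * N
    j≤DN = ≤-trans j≤e (≤-trans (<⇒≤ e<N) (m≤n*m N D {{>-nonZero (m<n⇒0<n∸m i<Q)}}))

module EnumerationSums (S : Setoid 0ℓ 0ℓ) (M : CommutativeMonoid 0ℓ 0ℓ) where
  open import Data.List using (List; []; _∷_; map; foldr)
  open import Data.List.Relation.Unary.Any as Any using (Any; here; there; _─_)
  open import Data.List.Relation.Unary.Any.Properties using (lookup-result)
  open import Data.List.Relation.Unary.All using (All; _∷_)
  open import Data.List.Relation.Unary.All.Properties using (─⁺)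
  open import Data.List.Relation.Unary.AllPairs using (AllPairs; _∷_)
  open import Data.Sum using (_⊎_; inj₁; inj₂)
  open import Relation.Nullary using (¬_; contradiction)

  open Setoid S renaming (Carrier to A)
  open CommutativeMonoid M
    using (_∙_; ε; ∙-cong; ∙-congˡ; identityˡ; identityʳ; commutativeSemigroup)
    renaming (Carrier to B; _≈_ to _≈ᴹ_; refl to reflᴹ; trans to transᴹ)
  open import Relation.Binary.Reasoning.Setoid (CommutativeMonoid.setoid M)
  open import Algebra.Properties.CommutativeSemigroup commutativeSemigroup using (x∙yz≈y∙xz)

  _∈_ : A → List A → Set
  x ∈ xs = Any (x ≈_) xs

  Distinct : List A → Set
  Distinct = AllPairs (λ x y → ¬ x ≈ y)

  fold : List B → B
  fold = foldr _∙_ ε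

  Congruent : (A → B) → Set
  Congruent g = ∀ {x y} → x ≈ y → g x ≈ᴹ g y

  lookup-∈ : ∀ {P : A → Set} xs (w : Any P xs) → Any.lookup w ∈ xs
  lookup-∈ (x ∷ xs) (here _)  = here refl
  lookup-∈ (x ∷ xs) (there w) = there (lookup-∈ xs w)

  ─-⊆ : ∀ {P Q : A → Set} xs (w : Any P xs) → Any Q (xs ─ w) → Any Q xs
  ─-⊆ (x ∷ xs) (here _)  v         = there v
  ─-⊆ (x ∷ xs) (there w) (here q)  = here q
  ─-⊆ (x ∷ xs) (there w) (there v) = there (─-⊆ xs w v)

  ─-split : ∀ {P Q : A → Set} xs (w : Any P xs) → Any Q xs → Q (Any.lookup w) ⊎ Any Q (xs ─ w)
  ─-split (x ∷ xs) (here _)  (here q)  = inj₁ q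
  ─-split (x ∷ xs) (here _)  (there v) = inj₂ v
  ─-split (x ∷ xs) (there w) (here q)  = inj₂ (here q)
  ─-split (x ∷ xs) (there w) (there v) with ─-split xs w v
  ... | inj₁ q  = inj₁ q
  ... | inj₂ v′ = inj₂ (there v′)

  ─-distinct : ∀ {P : A → Set} xs (w : Any P xs) → Distinct xs → Distinct (xs ─ w)
  ─-distinct (x ∷ xs) (here _)  (_ ∷ d)  = d
  ─-distinct (x ∷ xs) (there w) (h ∷ d)  = ─⁺ w h ∷ ─-distinct xs w d

  All¬≈⇒∉ : ∀ {x z ys} → All (λ y → ¬ x ≈ y) ys → z ∈ ys → ¬ z ≈ x
  All¬≈⇒∉ (x≉y ∷ _)  (here z≈y) z≈x = x≉y (trans (sym z≈x) z≈y)
  All¬≈⇒∉ (_ ∷ x≉ys) (there z∈) z≈x = All¬≈⇒∉ x≉ys z∈ z≈x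

  ─-excludes : ∀ {P : A → Set} xs (w : Any P xs) → Distinct xs → ∀ {z} → z ∈ (xs ─ w) → ¬ z ≈ Any.lookup w
  ─-excludes (x ∷ xs) (here _)  (h ∷ d) z∈        = All¬≈⇒∉ h z∈
  ─-excludes (x ∷ xs) (there w) (h ∷ d) (here z≈x) z≈l = All¬≈⇒∉ h (lookup-∈ xs w) (trans (sym z≈l) z≈x)
  ─-excludes (x ∷ xs) (there w) (h ∷ d) (there z∈) = ─-excludes xs w d z∈

  fold-─ : ∀ {P : A → Set} (g : A → B) xs (w : Any P xs) →
    fold (map g xs) ≈ᴹ g (Any.lookup w) ∙ fold (map g (xs ─ w))
  fold-─ g (x ∷ xs) (here _)  = reflᴹ
  fold-─ g (x ∷ xs) (there w) =
    transᴹ (∙-congˡ (fold-─ g xs w)) (x∙yz≈y∙xz (g x) (g (Any.lookup w)) _)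

  fold-ε : ∀ (g : A → B) xs → (∀ {x} → x ∈ xs → g x ≈ᴹ ε) → fold (map g xs) ≈ᴹ ε
  fold-ε g []       _     = reflᴹ
  fold-ε g (x ∷ xs) g≈ε = transᴹ (∙-cong (g≈ε (here refl)) (fold-ε g xs (λ x∈ → g≈ε (there x∈)))) (identityˡ ε)

  fold-single : ∀ (g : A → B) → Congruent g → ∀ xs → Distinct xs → ∀ {c} → c ∈ xs →
    (∀ x → ¬ x ≈ c → g x ≈ᴹ ε) → fold (map g xs) ≈ᴹ g c
  fold-single g g-cong xs d {c} c∈ vanish = begin
    fold (map g xs)                             ≈⟨ fold-─ g xs c∈ ⟩
    g (Any.lookup c∈) ∙ fold (map g (xs ─ c∈))  ≈⟨ ∙-cong (g-cong (sym (lookup-result c∈))) rest≈ε ⟩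
    g c ∙ ε                                     ≈⟨ identityʳ _ ⟩
    g c                                         ∎
    where
    rest≈ε : fold (map g (xs ─ c∈)) ≈ᴹ ε
    rest≈ε = fold-ε g (xs ─ c∈) (λ z∈ → vanish _ (λ z≈c →
      ─-excludes xs c∈ d z∈ (trans z≈c (lookup-result c∈))))

  fold-reindex : ∀ (h : A → B) → Congruent h → (σ : A → A) →
    (∀ {x y} → σ x ≈ σ y → x ≈ y) →
    ∀ xs ys → Distinct xs → Distinct ys →
    (∀ {x} → x ∈ xs → σ x ∈ ys) → (∀ {y} → y ∈ ys → Any (λ x → σ x ≈ y) xs) →
    fold (map (λ x → h (σ x)) xs) ≈ᴹ fold (map h ys)
  fold-reindex h h-cong σ σ-inj []       []       _  _ _    _    = reflᴹ
  fold-reindex h h-cong σ σ-inj (x ∷ xs) []       _  _ into _    with into (here refl)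
  ... | ()
  fold-reindex h h-cong σ σ-inj xs       (y ∷ ys) dx (y∉ys ∷ dy) into onto = begin
    fold (map (λ x → h (σ x)) xs)                          ≈⟨ fold-─ (λ x → h (σ x)) xs w ⟩
    h (σ (Any.lookup w)) ∙ fold (map (λ x → h (σ x)) xs′) ≈⟨ ∙-cong (h-cong (lookup-result w)) rest ⟩
    h y ∙ fold (map h ys)                                  ∎
    where
    w : Any (λ x → σ x ≈ y) xs
    w = onto (here refl)
    xs′ : List A
    xs′ = xs ─ w
    into′ : ∀ {x} → x ∈ xs′ → σ x ∈ ys
    into′ x∈ with into (─-⊆ xs w x∈)
    ... | here σx≈y = contradiction (σ-inj (trans σx≈y (sym (lookup-result w)))) (─-excludes xs w dx x∈)
    ... | there σx∈ = σx∈
    onto′ : ∀ {y′} → y′ ∈ ys → Any (λ x → σ x ≈ y′) xs′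
    onto′ y′∈ with ─-split xs w (onto (there y′∈))
    ... | inj₂ v = v
    ... | inj₁ σl≈y′ = contradiction (trans (sym σl≈y′) (lookup-result w)) (All¬≈⇒∉ y∉ys y′∈)
    rest : fold (map (λ x → h (σ x)) xs′) ≈ᴹ fold (map h ys)
    rest = fold-reindex h h-cong σ σ-inj xs′ ys (─-distinct xs w dx) dy into′ onto′

module FieldFacts (K : Field) where
  open import Data.Nat as ℕ using (ℕ; zero; suc; _∸_; _≤_; _<_; z≤n; s≤s)
  import Data.Nat.Properties as ℕₚ
  open import Data.Nat.Combinatorics using (_C_; nCk+nC[k+1]≡[n+1]C[k+1]; k>n⇒nCk≡0)
  open import Data.Integer using (+_)
  open import Data.List using (List; []; _∷_; map; length; foldr)
  open import Data.List.Relation.Unary.All using (All; []; _∷_)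
  open import Data.List.Relation.Unary.AllPairs using (AllPairs; _∷_)
  open import Data.Product as Product using (Σ-syntax; _,_)
  open import Data.Empty using (⊥)
  open import Relation.Nullary using (¬_; yes; no)
  open import Relation.Binary.PropositionalEquality as ≡ using (_≡_; _≢_)

  open IntegerSolver (Field.commRing K) public
  open FieldOps K public using (pow; fromℕ; sumL; Σ₁; _⁻¹; 1≉0; inverseʳ)
  open import Algebra.Properties.Semiring.Exp semiring using (_^_; ^-congˡ; ^-homo-*; ^-assocʳ)
  open import Algebra.Properties.CommutativeSemiring.Exp commutativeSemiring using (^-distrib-*)
  open import Algebra.Properties.Semiring.Mult.TCOptimised semiring using (_×_; 1+×; ×-homo-+; ×1-homo-*)
  open import Algebra.Properties.CommutativeSemigroup +-commutativeSemigroup using ()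
    renaming (interchange to +-interchange)

  -- Powers. Defs' pow is the library exponentiation, so its laws are inherited.
  pow≗^ : ∀ x n → pow x n ≡ x ^ n
  pow≗^ x zero    = ≡.refl
  pow≗^ x (suc n) = ≡.cong (x *_) (pow≗^ x n)

  pow-cong : ∀ n {x y} → x ≈ y → pow x n ≈ pow y n
  pow-cong n {x} {y} x≈y rewrite pow≗^ x n | pow≗^ y n = ^-congˡ n x≈y

  pow-congʳ : ∀ x {m n} → m ≡ n → pow x m ≈ pow x n
  pow-congʳ x ≡.refl = refl

  pow-+ : ∀ x m n → pow x (m ℕ.+ n) ≈ pow x m * pow x n
  pow-+ x m n rewrite pow≗^ x (m ℕ.+ n) | pow≗^ x m | pow≗^ x n = ^-homo-* x m n

  pow-* : ∀ x m n → pow x (m ℕ.* n) ≈ pow (pow x m) n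
  pow-* x m n rewrite pow≗^ x (m ℕ.* n) | pow≗^ x m | pow≗^ (x ^ m) n = sym (^-assocʳ x m n)

  pow-distrib-* : ∀ x y n → pow (x * y) n ≈ pow x n * pow y n
  pow-distrib-* x y n rewrite pow≗^ (x * y) n | pow≗^ x n | pow≗^ y n = ^-distrib-* x y n

  pow-1# : ∀ n → pow 1# n ≈ 1#
  pow-1# zero    = refl
  pow-1# (suc n) = trans (*-identityˡ _) (pow-1# n)

  pow-0# : ∀ {n} → 0 < n → pow 0# n ≈ 0#
  pow-0# {suc n} _ = zeroˡ _

  pow-neg : ∀ x k → pow (- x) k ≈ pow (- 1#) k * pow x k
  pow-neg x k = trans (pow-cong k (sym (-1*x≈-x x))) (pow-distrib-* (- 1#) x k)

  -- Defs' fromℕ is the library's n × 1#, so it is a semiring homomorphism.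
  fromℕ≈× : ∀ n → fromℕ n ≈ n × 1#
  fromℕ≈× zero    = refl
  fromℕ≈× (suc n) = trans (+-congˡ (fromℕ≈× n)) (sym (1+× n 1#))

  fromℕ-+ : ∀ m n → fromℕ (m ℕ.+ n) ≈ fromℕ m + fromℕ n
  fromℕ-+ m n = trans (fromℕ≈× (m ℕ.+ n))
    (trans (×-homo-+ 1# m n) (sym (+-cong (fromℕ≈× m) (fromℕ≈× n))))

  fromℕ-* : ∀ m n → fromℕ (m ℕ.* n) ≈ fromℕ m * fromℕ n
  fromℕ-* m n = trans (fromℕ≈× (m ℕ.* n))
    (trans (×1-homo-* m n) (sym (*-cong (fromℕ≈× m) (fromℕ≈× n))))

  fromℕ-^ : ∀ n k → fromℕ (n ℕ.^ k) ≈ pow (fromℕ n) k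
  fromℕ-^ n zero    = +-identityʳ 1#
  fromℕ-^ n (suc k) = trans (fromℕ-* n (n ℕ.^ k)) (*-congˡ (fromℕ-^ n k))

  NonZero : Carrier → Set
  NonZero x = ¬ x ≈ 0#

  inverseˡ : ∀ x → NonZero x → (x ⁻¹) * x ≈ 1#
  inverseˡ x x≉0 = trans (*-comm _ _) (inverseʳ x x≉0)

  x⁻¹*[x*y]≈y : ∀ {x} → NonZero x → ∀ y → (x ⁻¹) * (x * y) ≈ y
  x⁻¹*[x*y]≈y {x} x≉0 y = trans (sym (*-assoc _ _ _)) (trans (*-congʳ (inverseˡ x x≉0)) (*-identityˡ y))

  x*[x⁻¹*y]≈y : ∀ {x} → NonZero x → ∀ y → x * ((x ⁻¹) * y) ≈ y
  x*[x⁻¹*y]≈y {x} x≉0 y = trans (sym (*-assoc _ _ _)) (trans (*-congʳ (inverseʳ x x≉0)) (*-identityˡ y))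

  *-cancelˡ : ∀ x {a b} → NonZero x → x * a ≈ x * b → a ≈ b
  *-cancelˡ x {a} {b} x≉0 xa≈xb =
    trans (sym (x⁻¹*[x*y]≈y x≉0 a)) (trans (*-congˡ xa≈xb) (x⁻¹*[x*y]≈y x≉0 b))

  zero-product : ∀ x {y} → NonZero x → x * y ≈ 0# → y ≈ 0#
  zero-product x x≉0 xy≈0 = *-cancelˡ x x≉0 (trans xy≈0 (sym (zeroʳ x)))

  nonZero-* : ∀ {x y} → NonZero x → NonZero y → NonZero (x * y)
  nonZero-* {x} x≉0 y≉0 xy≈0 = y≉0 (zero-product x x≉0 xy≈0)

  nonZero-pow : ∀ {x} n → NonZero x → NonZero (pow x n)
  nonZero-pow zero    _   = 1≉0
  nonZero-pow (suc n) x≉0 = nonZero-* x≉0 (nonZero-pow n x≉0)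

  nonZero-inverse : ∀ {x} → NonZero x → NonZero (x ⁻¹)
  nonZero-inverse {x} x≉0 x⁻¹≈0 = 1≉0 (trans (sym (inverseʳ x x≉0)) (trans (*-congˡ x⁻¹≈0) (zeroʳ x)))

  inverse-neg-cancel : ∀ {x} y → NonZero x → - ((x ⁻¹) * - (x * y)) ≈ y
  inverse-neg-cancel {x} y x≉0 = begin
    - ((x ⁻¹) * - (x * y))   ≈⟨ -‿cong (-‿distribʳ-* (x ⁻¹) (x * y)) ⟨
    - - ((x ⁻¹) * (x * y))   ≈⟨ -‿involutive _ ⟩
    (x ⁻¹) * (x * y)         ≈⟨ x⁻¹*[x*y]≈y x≉0 y ⟩
    y                        ∎

  -1≉0 : NonZero (- 1#)
  -1≉0 -1≈0 = 1≉0 (trans (sym (-‿involutive 1#)) (trans (-‿cong -1≈0) -0#≈0#))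

  Σ₀ : ℕ → (ℕ → Carrier) → Carrier
  Σ₀ N f = f 0 + Σ₁ N f

  Σ₁-cong : ∀ N {f g : ℕ → Carrier} → (∀ j → 1 ≤ j → j ≤ N → f j ≈ g j) → Σ₁ N f ≈ Σ₁ N g
  Σ₁-cong zero    f≈g = refl
  Σ₁-cong (suc N) f≈g = +-cong (Σ₁-cong N (λ j 1≤j j≤N → f≈g j 1≤j (ℕₚ.m≤n⇒m≤1+n j≤N)))
                               (f≈g (suc N) (s≤s z≤n) ℕₚ.≤-refl)

  Σ₁-zero : ∀ N (f : ℕ → Carrier) → (∀ j → 1 ≤ j → j ≤ N → f j ≈ 0#) → Σ₁ N f ≈ 0#
  Σ₁-zero zero    f f≈0 = refl
  Σ₁-zero (suc N) f f≈0 = trans (+-cong (Σ₁-zero N f (λ j 1≤j j≤N → f≈0 j 1≤j (ℕₚ.m≤n⇒m≤1+n j≤N)))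
                                        (f≈0 (suc N) (s≤s z≤n) ℕₚ.≤-refl))
                                 (+-identityˡ 0#)

  Σ₁-+ : ∀ N (f g : ℕ → Carrier) → Σ₁ N (λ j → f j + g j) ≈ Σ₁ N f + Σ₁ N g
  Σ₁-+ zero    f g = sym (+-identityˡ 0#)
  Σ₁-+ (suc N) f g = trans (+-congʳ (Σ₁-+ N f g)) (+-interchange _ _ _ _)

  Σ₁-*ˡ : ∀ N a (f : ℕ → Carrier) → a * Σ₁ N f ≈ Σ₁ N (λ j → a * f j)
  Σ₁-*ˡ zero    a f = zeroʳ a
  Σ₁-*ˡ (suc N) a f = trans (distribˡ _ _ _) (+-congʳ (Σ₁-*ˡ N a f))

  Σ₁-neg : ∀ N (f : ℕ → Carrier) → - Σ₁ N f ≈ Σ₁ N (λ j → - f j)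
  Σ₁-neg zero    f = -0#≈0#
  Σ₁-neg (suc N) f = trans (sym (-‿+-comm _ _)) (+-congʳ (Σ₁-neg N f))

  Σ₁-shift : ∀ N (g : ℕ → Carrier) → Σ₁ (suc N) g ≈ Σ₀ N (λ i → g (suc i))
  Σ₁-shift zero    g = trans (+-identityˡ _) (sym (+-identityʳ _))
  Σ₁-shift (suc N) g = trans (+-congʳ (Σ₁-shift N g)) (+-assoc _ _ _)

  Σ₀-cong : ∀ N {f g : ℕ → Carrier} → (∀ j → j ≤ N → f j ≈ g j) → Σ₀ N f ≈ Σ₀ N g
  Σ₀-cong N f≈g = +-cong (f≈g 0 z≤n) (Σ₁-cong N (λ j _ j≤N → f≈g j j≤N))

  Σ₀-suc : ∀ N f → Σ₀ (suc N) f ≈ Σ₀ N f + f (suc N)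
  Σ₀-suc N f = sym (+-assoc _ _ _)

  Σ₀-last : ∀ {M M′} (f : ℕ → Carrier) → M ≡ suc M′ → Σ₀ M f ≈ Σ₀ M′ f + f M
  Σ₀-last {M′ = M′} f ≡.refl = Σ₀-suc M′ f

  Σ₀-*ˡ : ∀ N a (f : ℕ → Carrier) → a * Σ₀ N f ≈ Σ₀ N (λ j → a * f j)
  Σ₀-*ˡ N a f = trans (distribˡ _ _ _) (+-congˡ (Σ₁-*ˡ N a f))

  Σ₀-*ʳ : ∀ N a (f : ℕ → Carrier) → Σ₀ N f * a ≈ Σ₀ N (λ j → f j * a)
  Σ₀-*ʳ N a f = trans (*-comm _ _) (trans (Σ₀-*ˡ N a f) (Σ₀-cong N (λ j _ → *-comm _ _)))

  Σ₀-product : ∀ M L (f g : ℕ → Carrier) → Σ₀ M f * Σ₀ L g ≈ Σ₀ M (λ j → Σ₀ L (λ k → f j * g k))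
  Σ₀-product M L f g = trans (Σ₀-*ʳ M (Σ₀ L g) f) (Σ₀-cong M (λ j _ → Σ₀-*ˡ L (f j) g))

  Σ₀-zero : ∀ N (f : ℕ → Carrier) → (∀ j → j ≤ N → f j ≈ 0#) → Σ₀ N f ≈ 0#
  Σ₀-zero N f f≈0 = trans (+-cong (f≈0 0 z≤n) (Σ₁-zero N f (λ j _ j≤N → f≈0 j j≤N))) (+-identityˡ 0#)

  Σ₀-single : ∀ N (f : ℕ → Carrier) k → k ≤ N → (∀ j → j ≤ N → j ≢ k → f j ≈ 0#) → Σ₀ N f ≈ f k
  Σ₀-single zero    f zero k≤N others = +-identityʳ _
  Σ₀-single (suc N) f k k≤N others with k ℕ.≟ suc N
  ... | yes ≡.refl = begin
    Σ₀ (suc N) f         ≈⟨ Σ₀-suc N f ⟩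
    Σ₀ N f + f (suc N)   ≈⟨ +-congʳ (Σ₀-zero N f (λ j j≤N → others j (ℕₚ.m≤n⇒m≤1+n j≤N) (ℕₚ.<⇒≢ (s≤s j≤N)))) ⟩
    0# + f (suc N)       ≈⟨ +-identityˡ _ ⟩
    f (suc N)            ∎
  ... | no k≢N+1 = begin
    Σ₀ (suc N) f         ≈⟨ Σ₀-suc N f ⟩
    Σ₀ N f + f (suc N)   ≈⟨ +-cong (Σ₀-single N f k (ℕₚ.≤-pred (ℕₚ.≤∧≢⇒< k≤N k≢N+1))
                                     (λ j j≤N → others j (ℕₚ.m≤n⇒m≤1+n j≤N)))
                                   (others (suc N) ℕₚ.≤-refl (λ N+1≡k → k≢N+1 (≡.sym N+1≡k))) ⟩
    f k + 0#             ≈⟨ +-identityʳ _ ⟩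
    f k                  ∎

  sumL≡foldr : ∀ xs → sumL xs ≡ foldr _+_ 0# xs
  sumL≡foldr []       = ≡.refl
  sumL≡foldr (x ∷ xs) = ≡.cong (λ s → x + s) (sumL≡foldr xs)

  sumL-cong : ∀ {A : Set} (xs : List A) {f g : A → Carrier} → (∀ x → f x ≈ g x) →
    sumL (map f xs) ≈ sumL (map g xs)
  sumL-cong []       f≈g = refl
  sumL-cong (x ∷ xs) f≈g = +-cong (f≈g x) (sumL-cong xs f≈g)

  sumL-+ : ∀ {A : Set} (xs : List A) (f g : A → Carrier) →
    sumL (map (λ x → f x + g x) xs) ≈ sumL (map f xs) + sumL (map g xs)
  sumL-+ []       f g = sym (+-identityˡ 0#)
  sumL-+ (x ∷ xs) f g = trans (+-congˡ (sumL-+ xs f g)) (+-interchange _ _ _ _)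

  sumL-*ˡ : ∀ {A : Set} (xs : List A) a (f : A → Carrier) →
    a * sumL (map f xs) ≈ sumL (map (λ x → a * f x) xs)
  sumL-*ˡ []       a f = zeroʳ a
  sumL-*ˡ (x ∷ xs) a f = trans (distribˡ _ _ _) (+-congˡ (sumL-*ˡ xs a f))

  sumL-zero : ∀ {A : Set} (xs : List A) → sumL (map (λ _ → 0#) xs) ≈ 0#
  sumL-zero []       = refl
  sumL-zero (x ∷ xs) = trans (+-identityˡ _) (sumL-zero xs)

  sumL-1# : ∀ {A : Set} (xs : List A) → sumL (map (λ _ → 1#) xs) ≈ fromℕ (length xs)
  sumL-1# []       = refl
  sumL-1# (x ∷ xs) = +-congˡ (sumL-1# xs)

  sumL-Σ₁ : ∀ {A : Set} (xs : List A) N (g : A → ℕ → Carrier) →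
    sumL (map (λ x → Σ₁ N (g x)) xs) ≈ Σ₁ N (λ j → sumL (map (λ x → g x j) xs))
  sumL-Σ₁ xs zero    g = sumL-zero xs
  sumL-Σ₁ xs (suc N) g = trans (sumL-+ xs (λ x → Σ₁ N (g x)) (λ x → g x (suc N))) (+-congʳ (sumL-Σ₁ xs N g))

  sumL-Σ₀ : ∀ {A : Set} (xs : List A) N (g : A → ℕ → Carrier) →
    sumL (map (λ x → Σ₀ N (g x)) xs) ≈ Σ₀ N (λ j → sumL (map (λ x → g x j) xs))
  sumL-Σ₀ xs N g = trans (sumL-+ xs (λ x → g x 0) (λ x → Σ₁ N (g x))) (+-congˡ (sumL-Σ₁ xs N g))

  -- The binomial theorem (x + y)^k = Σ_{j ≤ k} C(k,j) x^(k-j) y^j, by induction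
  -- on k: multiply the expansion of (x + y)^k by x and by y, and add the two
  -- results termwise with Pascal's rule.
  binomialTerm : ℕ → Carrier → Carrier → ℕ → Carrier
  binomialTerm k x y j = fromℕ (k C j) * (pow x (k ∸ j) * pow y j)

  binomial-*x : ∀ k x y →
    x * Σ₀ k (binomialTerm k x y) ≈ Σ₀ (suc k) (λ j → fromℕ (k C j) * (pow x (suc k ∸ j) * pow y j))
  binomial-*x k x y = begin
    x * Σ₀ k (binomialTerm k x y)                 ≈⟨ Σ₀-*ˡ k x (binomialTerm k x y) ⟩
    Σ₀ k (λ j → x * binomialTerm k x y j)         ≈⟨ Σ₀-cong k x*T ⟩
    Σ₀ k X                                        ≈⟨ +-identityʳ _ ⟨
    Σ₀ k X + 0#                                   ≈⟨ +-congˡ X-top ⟨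
    Σ₀ k X + X (suc k)                            ≈⟨ Σ₀-suc k X ⟨
    Σ₀ (suc k) X                                  ∎
    where
    X : ℕ → Carrier
    X j = fromℕ (k C j) * (pow x (suc k ∸ j) * pow y j)
    X-top : X (suc k) ≈ 0#
    X-top = trans (*-congʳ (reflexive (≡.cong fromℕ (k>n⇒nCk≡0 (ℕₚ.n<1+n k))))) (zeroˡ _)
    x*T : ∀ j → j ≤ k → x * binomialTerm k x y j ≈ X j
    x*T j j≤k = begin
      x * (fromℕ (k C j) * (pow x (k ∸ j) * pow y j))   ≈⟨ solve 4 (λ x c a b → x :* (c :* (a :* b)) := c :* ((x :* a) :* b)) refl x _ _ _ ⟩
      fromℕ (k C j) * ((x * pow x (k ∸ j)) * pow y j)   ≈⟨ *-congˡ (*-congʳ (pow-congʳ x (≡.sym (ℕₚ.+-∸-assoc 1 j≤k)))) ⟩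
      X j                                               ∎

  binomial-*y : ∀ k x y →
    y * Σ₀ k (binomialTerm k x y) ≈ Σ₁ (suc k) (λ j → fromℕ (k C ℕ.pred j) * (pow x (suc k ∸ j) * pow y j))
  binomial-*y k x y = begin
    y * Σ₀ k (binomialTerm k x y)            ≈⟨ Σ₀-*ˡ k y (binomialTerm k x y) ⟩
    Σ₀ k (λ j → y * binomialTerm k x y j)    ≈⟨ Σ₀-cong k (λ j _ → solve 4 (λ y c a b → y :* (c :* (a :* b)) := c :* (a :* (y :* b))) refl y _ _ _) ⟩
    Σ₀ k (λ i → Y (suc i))                   ≈⟨ Σ₁-shift k Y ⟨
    Σ₁ (suc k) Y                             ∎
    where
    Y : ℕ → Carrier
    Y j = fromℕ (k C ℕ.pred j) * (pow x (suc k ∸ j) * pow y j)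

  pascal : ∀ k x y j → 1 ≤ j →
    fromℕ (k C j) * (pow x (suc k ∸ j) * pow y j) + fromℕ (k C ℕ.pred j) * (pow x (suc k ∸ j) * pow y j)
      ≈ binomialTerm (suc k) x y j
  pascal k x y (suc i) _ = begin
    fromℕ (k C suc i) * P + fromℕ (k C i) * P   ≈⟨ distribʳ _ _ _ ⟨
    (fromℕ (k C suc i) + fromℕ (k C i)) * P     ≈⟨ *-congʳ (fromℕ-+ (k C suc i) (k C i)) ⟨
    fromℕ (k C suc i ℕ.+ k C i) * P             ≡⟨ ≡.cong (λ c → fromℕ c * P) (ℕₚ.+-comm (k C suc i) (k C i)) ⟩
    fromℕ (k C i ℕ.+ k C suc i) * P             ≡⟨ ≡.cong (λ c → fromℕ c * P) (nCk+nC[k+1]≡[n+1]C[k+1] k i) ⟩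
    fromℕ (suc k C suc i) * P                   ∎
    where
    P : Carrier
    P = pow x (k ∸ i) * pow y (suc i)

  binomial : ∀ k x y → pow (x + y) k ≈ Σ₀ k (binomialTerm k x y)
  binomial zero    x y = sym (trans (+-identityʳ _) (trans (*-congʳ (+-identityʳ 1#)) (trans (*-identityˡ _) (*-identityˡ _))))
  binomial (suc k) x y = begin
    (x + y) * pow (x + y) k                            ≈⟨ *-congˡ (binomial k x y) ⟩
    (x + y) * Σ₀ k T                                   ≈⟨ distribʳ _ _ _ ⟩
    x * Σ₀ k T + y * Σ₀ k T                            ≈⟨ +-cong (binomial-*x k x y) (binomial-*y k x y) ⟩
    Σ₀ (suc k) X + Σ₁ (suc k) Y                        ≈⟨ +-assoc _ _ _ ⟩
    X 0 + (Σ₁ (suc k) X + Σ₁ (suc k) Y)                ≈⟨ +-congˡ (Σ₁-+ (suc k) X Y) ⟨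
    X 0 + Σ₁ (suc k) (λ j → X j + Y j)                 ≈⟨ +-congˡ (Σ₁-cong (suc k) (λ j 1≤j _ → pascal k x y j 1≤j)) ⟩
    Σ₀ (suc k) (binomialTerm (suc k) x y)              ∎
    where
    T X Y : ℕ → Carrier
    T = binomialTerm k x y
    X j = fromℕ (k C j) * (pow x (suc k ∸ j) * pow y j)
    Y j = fromℕ (k C ℕ.pred j) * (pow x (suc k ∸ j) * pow y j)

  geometric : ∀ n u w → (u - w) * Σ₀ n (λ k → pow u (n ∸ k) * pow w k) ≈ pow u (suc n) - pow w (suc n)
  geometric zero    u w = solve 2 (λ u w → (u :- w) :* ((con (+ 1) :* con (+ 1)) :+ con (+ 0)) := (u :* con (+ 1)) :- (w :* con (+ 1))) refl u w
  geometric (suc n) u w = begin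
    (u - w) * Σ₀ (suc n) G′                          ≈⟨ *-congˡ (Σ₀-suc n G′) ⟩
    (u - w) * (Σ₀ n G′ + G′ (suc n))                 ≈⟨ *-congˡ (+-cong (Σ₀-cong n G′≈uG) G′-top) ⟩
    (u - w) * (Σ₀ n (λ k → u * G k) + pow w (suc n)) ≈⟨ *-congˡ (+-congʳ (Σ₀-*ˡ n u G)) ⟨
    (u - w) * (u * Σ₀ n G + pow w (suc n))           ≈⟨ solve 4 (λ u w A C → (u :- w) :* (u :* A :+ C) := u :* ((u :- w) :* A) :+ (u :- w) :* C) refl u w (Σ₀ n G) (pow w (suc n)) ⟩
    u * ((u - w) * Σ₀ n G) + (u - w) * pow w (suc n) ≈⟨ +-congʳ (*-congˡ (geometric n u w)) ⟩
    u * (pow u (suc n) - pow w (suc n)) + (u - w) * pow w (suc n) ≈⟨ solve 4 (λ u w B C → u :* (B :- C) :+ (u :- w) :* C := u :* B :- w :* C) refl u w (pow u (suc n)) (pow w (suc n)) ⟩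
    pow u (suc (suc n)) - pow w (suc (suc n))        ∎
    where
    G G′ : ℕ → Carrier
    G k  = pow u (n ∸ k) * pow w k
    G′ k = pow u (suc n ∸ k) * pow w k
    G′≈uG : ∀ k → k ≤ n → G′ k ≈ u * G k
    G′≈uG k k≤n = trans (*-congʳ (pow-congʳ u (ℕₚ.+-∸-assoc 1 k≤n))) (*-assoc _ _ _)
    G′-top : G′ (suc n) ≈ pow w (suc n)
    G′-top = trans (*-congʳ (pow-congʳ u (ℕₚ.n∸n≡0 n))) (*-identityˡ _)

  -- Root bound. IsPolynomial d c f says that f is a polynomial function of
  -- degree d with leading coefficient c (written in Horner form).
  IsPolynomial : ℕ → Carrier → (Carrier → Carrier) → Set
  IsPolynomial zero    c f = ∀ x → f x ≈ c
  IsPolynomial (suc d) c f = Σ[ a ∈ Carrier ] Σ[ g ∈ (Carrier → Carrier) ]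
    IsPolynomial d c g Product.× (∀ x → f x ≈ a + x * g x)

  divide-linear : ∀ d c f → IsPolynomial (suc d) c f → ∀ r →
    Σ[ h ∈ (Carrier → Carrier) ] IsPolynomial d c h Product.× (∀ x → f x ≈ f r + (x - r) * h x)
  divide-linear zero c f (a , g , g≈c , f≈) r = g , g≈c , λ x → begin
    f x                          ≈⟨ f≈ x ⟩
    a + x * g x                  ≈⟨ +-congˡ (*-congˡ (g≈c x)) ⟩
    a + x * c                    ≈⟨ solve 4 (λ a x r c → a :+ x :* c := (a :+ r :* c) :+ (x :- r) :* c) refl a x r c ⟩
    (a + r * c) + (x - r) * c    ≈⟨ +-cong (sym (trans (f≈ r) (+-congˡ (*-congˡ (g≈c r))))) (*-congˡ (sym (g≈c x))) ⟩
    f r + (x - r) * g x          ∎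
  divide-linear (suc d) c f (a , g , g-poly , f≈) r with divide-linear d c g g-poly r
  ... | h , h-poly , g≈ = (λ x → g r + x * h x) , (g r , h , h-poly , λ x → refl) , λ x → begin
    f x                                        ≈⟨ f≈ x ⟩
    a + x * g x                                ≈⟨ +-congˡ (*-congˡ (g≈ x)) ⟩
    a + x * (g r + (x - r) * h x)              ≈⟨ solve 5 (λ a x r G H → a :+ x :* (G :+ (x :- r) :* H) := (a :+ r :* G) :+ (x :- r) :* (G :+ x :* H)) refl a x r (g r) (h x) ⟩
    (a + r * g r) + (x - r) * (g r + x * h x)  ≈⟨ +-congʳ (sym (f≈ r)) ⟩
    f r + (x - r) * (g r + x * h x)            ∎

  root-bound : ∀ d c f → NonZero c → IsPolynomial d c f →
    ∀ rs → AllPairs (λ x y → ¬ x ≈ y) rs → suc d ≤ length rs → All (λ r → f r ≈ 0#) rs → ⊥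
  root-bound zero    c f c≉0 f≈c (r ∷ rs) _ _ (fr≈0 ∷ _) = c≉0 (trans (sym (f≈c r)) fr≈0)
  root-bound (suc d) c f c≉0 f-poly (r ∷ rs) (r≉rs ∷ distinct) (s≤s len) (fr≈0 ∷ frs≈0)
    with divide-linear d c f f-poly r
  ... | h , h-poly , f≈ = root-bound d c h c≉0 h-poly rs distinct len (roots-of-quotient rs r≉rs frs≈0)
    where
    roots-of-quotient : ∀ ss → All (λ s → ¬ r ≈ s) ss → All (λ s → f s ≈ 0#) ss → All (λ s → h s ≈ 0#) ss
    roots-of-quotient []       []           []           = []
    roots-of-quotient (s ∷ ss) (r≉s ∷ r≉ss) (fs≈0 ∷ fss) =
      zero-product (s - r) (λ s-r≈0 → r≉s (sym (x∙y⁻¹≈ε⇒x≈y s r s-r≈0))) (begin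
        (s - r) * h s                 ≈⟨ solve 2 (λ a b → a := (b :+ a) :- b) refl _ (f r) ⟩
        (f r + (s - r) * h s) - f r   ≈⟨ +-cong (sym (f≈ s)) (-‿cong fr≈0) ⟩
        f s - 0#                      ≈⟨ +-cong fs≈0 -0#≈0# ⟩
        0# + 0#                       ≈⟨ +-identityʳ _ ⟩
        0#                            ∎)
      ∷ roots-of-quotient ss r≉ss fss

  pow-isPolynomial : ∀ n → IsPolynomial n 1# (λ x → pow x n)
  pow-isPolynomial zero    x = refl
  pow-isPolynomial (suc n) = 0# , (λ x → pow x n) , pow-isPolynomial n , (λ x → sym (+-identityˡ _))

module Frobenius (K : Field) where
  open import Data.Nat as ℕ using (ℕ; zero; suc; _∸_; _<_; s≤s)
  import Data.Nat.Properties as ℕₚ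
  open import Data.Nat.Combinatorics using (_C_; nCn≡1)
  open import Data.Nat.Divisibility using (_∣_; divides)
  open import Data.Nat.Primality using (Prime; prime⇒nonZero)
  open import Data.Integer using (+_)
  open import Relation.Binary.PropositionalEquality as ≡ using (_≡_)
  open NatFacts
  open FieldFacts K

  multiple-of-char : ∀ {p c} → fromℕ p ≈ 0# → p ∣ c → fromℕ c ≈ 0#
  multiple-of-char {p} char-p (divides w ≡.refl) = trans (fromℕ-* w p) (trans (*-congˡ char-p) (zeroʳ _))

  -- (x + y)^p = x^p + y^p: the inner binomial coefficients vanish.
  frobenius : ∀ {p} → Prime p → fromℕ p ≈ 0# → ∀ x y → pow (x + y) p ≈ pow x p + pow y p
  frobenius {suc n} p-prime char-p x y = begin
    pow (x + y) (suc n)                    ≈⟨ binomial (suc n) x y ⟩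
    V 0 + (Σ₁ n V + V (suc n))             ≈⟨ +-cong V₀ (+-cong middle Vₚ) ⟩
    pow x (suc n) + (0# + pow y (suc n))   ≈⟨ +-congˡ (+-identityˡ _) ⟩
    pow x (suc n) + pow y (suc n)          ∎
    where
    V : ℕ → Carrier
    V j = fromℕ (suc n C j) * (pow x (suc n ∸ j) * pow y j)
    V₀ : V 0 ≈ pow x (suc n)
    V₀ = trans (*-congʳ (+-identityʳ 1#)) (trans (*-identityˡ _) (*-identityʳ _))
    Vₚ : V (suc n) ≈ pow y (suc n)
    Vₚ = begin
      fromℕ (suc n C suc n) * (pow x (n ∸ n) * pow y (suc n)) ≡⟨ ≡.cong (λ c → fromℕ c * (pow x (n ∸ n) * pow y (suc n))) (nCn≡1 (suc n)) ⟩
      (1# + 0#) * (pow x (n ∸ n) * pow y (suc n))              ≈⟨ trans (*-congʳ (+-identityʳ 1#)) (*-identityˡ _) ⟩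
      pow x (n ∸ n) * pow y (suc n)                             ≈⟨ *-congʳ (pow-congʳ x (ℕₚ.n∸n≡0 n)) ⟩
      1# * pow y (suc n)                                        ≈⟨ *-identityˡ _ ⟩
      pow y (suc n)                                             ∎
    middle : Σ₁ n V ≈ 0#
    middle = Σ₁-zero n V (λ j 1≤j j≤n →
      trans (*-congʳ (multiple-of-char char-p (prime∣binomial p-prime j 1≤j (s≤s j≤n)))) (zeroˡ _))

  module _ {p : ℕ} (p-prime : Prime p) (char-p : fromℕ p ≈ 0#) where

    frobenius-^ : ∀ m x y → pow (x + y) (p ℕ.^ m) ≈ pow x (p ℕ.^ m) + pow y (p ℕ.^ m)
    frobenius-^ zero    x y = trans (*-identityʳ _) (sym (+-cong (*-identityʳ x) (*-identityʳ y)))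
    frobenius-^ (suc m) x y = begin
      pow (x + y) (p ℕ.* p ℕ.^ m)                        ≈⟨ pow-* (x + y) p (p ℕ.^ m) ⟩
      pow (pow (x + y) p) (p ℕ.^ m)                      ≈⟨ pow-cong (p ℕ.^ m) (frobenius p-prime char-p x y) ⟩
      pow (pow x p + pow y p) (p ℕ.^ m)                  ≈⟨ frobenius-^ m _ _ ⟩
      pow (pow x p) (p ℕ.^ m) + pow (pow y p) (p ℕ.^ m)  ≈⟨ +-cong (pow-* x p (p ℕ.^ m)) (pow-* y p (p ℕ.^ m)) ⟨
      pow x (p ℕ.* p ℕ.^ m) + pow y (p ℕ.* p ℕ.^ m)      ∎

    -- (-1)^(p^m) = -1, because (-1)^(p^m) + 1 = (-1 + 1)^(p^m) = 0
    pow-minus-one : ∀ m → pow (- 1#) (p ℕ.^ m) ≈ - 1#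
    pow-minus-one m = begin
      pow (- 1#) N                      ≈⟨ solve 1 (λ a → a := (a :+ con (+ 1)) :- con (+ 1)) refl _ ⟩
      (pow (- 1#) N + 1#) - 1#          ≈⟨ +-congʳ (+-congˡ (pow-1# N)) ⟨
      (pow (- 1#) N + pow 1# N) - 1#    ≈⟨ +-congʳ (frobenius-^ m (- 1#) 1#) ⟨
      pow (- 1# + 1#) N - 1#            ≈⟨ +-congʳ (trans (pow-cong N (-‿inverseˡ 1#)) (pow-0# N>0)) ⟩
      0# - 1#                           ≈⟨ +-identityˡ _ ⟩
      - 1#                              ∎
      where
      N : ℕ
      N = p ℕ.^ m
      N>0 : 0 < N
      N>0 = ℕₚ.m^n>0 p {{prime⇒nonZero p-prime}} m

    frobenius-^-sub : ∀ m x y → pow (x - y) (p ℕ.^ m) ≈ pow x (p ℕ.^ m) - pow y (p ℕ.^ m)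
    frobenius-^-sub m x y = begin
      pow (x - y) N                  ≈⟨ frobenius-^ m x (- y) ⟩
      pow x N + pow (- y) N          ≈⟨ +-congˡ (pow-neg y N) ⟩
      pow x N + pow (- 1#) N * pow y N ≈⟨ +-congˡ (*-congʳ (pow-minus-one m)) ⟩
      pow x N + - 1# * pow y N       ≈⟨ +-congˡ (-1*x≈-x _) ⟩
      pow x N - pow y N              ∎
      where
      N : ℕ
      N = p ℕ.^ m

    -- For q = p^k and u + v ≠ 0, the geometric sum expands
    -- (u + v)^(q-1) = Σ_{j ≤ q-1} u^(q-1-j) (-v)^j, because
    -- (u + v)·(u + v)^(q-1) = u^q + v^q = u^q - (-v)^q.
    pow-pred-expansion : ∀ k Q → p ℕ.^ k ≡ suc Q → ∀ u v → NonZero (u + v) →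
      pow (u + v) Q ≈ Σ₀ Q (λ j → pow u (Q ∸ j) * pow (- v) j)
    pow-pred-expansion k Q q≡1+Q u v u+v≉0 = *-cancelˡ (u + v) u+v≉0 (begin
      (u + v) * pow (u + v) Q                   ≈⟨ pow-congʳ (u + v) q≡1+Q ⟨
      pow (u + v) (p ℕ.^ k)                     ≈⟨ frobenius-^ k u v ⟩
      pow u (p ℕ.^ k) + pow v (p ℕ.^ k)         ≈⟨ +-cong (pow-congʳ u q≡1+Q) (sym -[-v]^q≈v^q) ⟩
      pow u (suc Q) - pow (- v) (suc Q)         ≈⟨ geometric Q u (- v) ⟨
      (u - - v) * Σ₀ Q (λ j → pow u (Q ∸ j) * pow (- v) j)   ≈⟨ *-congʳ (+-congˡ (-‿involutive v)) ⟩
      (u + v) * Σ₀ Q (λ j → pow u (Q ∸ j) * pow (- v) j)     ∎)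
      where
      -[-v]^q≈v^q : - pow (- v) (suc Q) ≈ pow v (p ℕ.^ k)
      -[-v]^q≈v^q = begin
        - pow (- v) (suc Q)                   ≈⟨ -‿cong (pow-congʳ (- v) q≡1+Q) ⟨
        - pow (- v) (p ℕ.^ k)                 ≈⟨ -‿cong (trans (pow-neg v (p ℕ.^ k)) (*-congʳ (pow-minus-one k))) ⟩
        - (- 1# * pow v (p ℕ.^ k))            ≈⟨ trans (-‿cong (-1*x≈-x _)) (-‿involutive _) ⟩
        pow v (p ℕ.^ k)                       ∎

module FiniteField (F : Field) (es : List (Field.Carrier F)) (enum : Enumerates F es) where
  open import Data.Nat as ℕ using (ℕ; zero; suc; _≤_; _<_; z≤n; s≤s)
  import Data.Nat.Properties as ℕₚ
  open import Data.Nat.Divisibility using (_∣_; divides; m%n≡0⇒n∣m)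
  open import Data.Nat.DivMod using (_%_; _/_; m≡m%n+[m/n]*n; m%n<n)
  open import Data.Integer using (+_)
  open import Data.List using ([]; _∷_; map; length)
  open import Data.List.Properties using (length-removeAt′)
  open import Data.List.Relation.Unary.Any as Any using (Any; here; there; _─_)
  open import Data.List.Relation.Unary.Any.Properties using (lookup-result)
  open import Data.List.Relation.Unary.All using (All; []; _∷_)
  open import Data.List.Relation.Unary.AllPairs using (_∷_)
  open import Data.Product using (_,_)
  open import Data.Sum using (inj₁; inj₂)
  open import Data.Empty using (⊥; ⊥-elim)
  open import Relation.Nullary using (¬_; Dec; yes; no; contradiction)
  open import Relation.Binary.PropositionalEquality as ≡ using (_≡_)

  open FieldFacts F public
  open Enumerates enum

  q : ℕ
  q = length es

  module FieldSumsOverF (K : Field) where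
    private
      module K = FieldFacts K
    open EnumerationSums setoid K.+-commutativeMonoid using (Congruent; fold; fold-reindex; fold-single)

    sum-permute : (h : Carrier → K.Carrier) → Congruent h →
      (σ τ : Carrier → Carrier) → (∀ {x y} → x ≈ y → σ x ≈ σ y) → (∀ {x y} → x ≈ y → τ x ≈ τ y) →
      (∀ x → τ (σ x) ≈ x) → (∀ y → σ (τ y) ≈ y) →
      K.sumL (map (λ x → h (σ x)) es) K.≈ K.sumL (map h es)
    sum-permute h h-cong σ τ σ-cong τ-cong τσ στ = K.begin
      K.sumL (map (λ x → h (σ x)) es)   K.≡⟨ K.sumL≡foldr (map (λ x → h (σ x)) es) ⟩
      fold (map (λ x → h (σ x)) es)     K.≈⟨ fold-reindex h h-cong σ σ-inj es es distinct distinct (λ _ → complete _) onto ⟩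
      fold (map h es)                   K.≡⟨ K.sumL≡foldr (map h es) ⟨
      K.sumL (map h es)                 K.∎
      where
      σ-inj : ∀ {x y} → σ x ≈ σ y → x ≈ y
      σ-inj {x} {y} σx≈σy = trans (sym (τσ x)) (trans (τ-cong σx≈σy) (τσ y))
      onto : ∀ {y} → Any (y ≈_) es → Any (λ x → σ x ≈ y) es
      onto {y} _ = Any.map (λ τy≈x → trans (σ-cong (sym τy≈x)) (στ y)) (complete (τ y))

    sum-single : (g : Carrier → K.Carrier) → Congruent g → ∀ c →
      (∀ x → ¬ x ≈ c → g x K.≈ K.0#) → K.sumL (map g es) K.≈ g c
    sum-single g g-cong c vanish = K.begin
      K.sumL (map g es)   K.≡⟨ K.sumL≡foldr (map g es) ⟩
      fold (map g es)     K.≈⟨ fold-single g g-cong es distinct (complete c) vanish ⟩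
      g c                 K.∎

  open FieldSumsOverF F
  open EnumerationSums setoid *-commutativeMonoid
    using (_∈_; Distinct; fold-reindex; ─-split; ─-distinct; ─-excludes; All¬≈⇒∉)
    renaming (fold to product)

  -- Equality in F is decidable: compare positions in the enumeration.
  infix 4 _≟_
  _≟_ : ∀ x y → Dec (x ≈ y)
  x ≟ y = compare distinct (complete x) (complete y)
    where
    compare : ∀ {xs} → Distinct xs → ∀ {x y} → x ∈ xs → y ∈ xs → Dec (x ≈ y)
    compare _           (here x≈e)  (here y≈e)  = yes (trans x≈e (sym y≈e))
    compare (e∉ ∷ _)    (here x≈e)  (there y∈)  = no (λ x≈y → All¬≈⇒∉ e∉ y∈ (trans (sym x≈y) x≈e))
    compare (e∉ ∷ _)    (there x∈)  (here y≈e)  = no (λ x≈y → All¬≈⇒∉ e∉ x∈ (trans x≈y y≈e))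
    compare (_ ∷ d)     (there x∈)  (there y∈)  = compare d x∈ y∈

  -- The characteristic divides q: summing x + 1 over F is summing x over F.
  q·1≈0 : fromℕ q ≈ 0#
  q·1≈0 = begin
    fromℕ q                                 ≈⟨ solve 2 (λ S n → n := (S :+ n) :- S) refl S (fromℕ q) ⟩
    (S + fromℕ q) - S                       ≈⟨ +-congʳ (+-congˡ (sumL-1# es)) ⟨
    (S + sumL (map (λ _ → 1#) es)) - S      ≈⟨ +-congʳ (sumL-+ es (λ x → x) (λ _ → 1#)) ⟨
    sumL (map (λ x → x + 1#) es) - S        ≈⟨ +-congʳ (sum-permute (λ x → x) (λ x≈y → x≈y) (_+ 1#) (_- 1#)
                                                 +-congʳ +-congʳ +1-1 -1+1) ⟩
    S - S                                   ≈⟨ -‿inverseʳ S ⟩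
    0#                                      ∎
    where
    S : Carrier
    S = sumL (map (λ x → x) es)
    +1-1 : ∀ x → (x + 1#) - 1# ≈ x
    +1-1 x = solve 1 (λ x → (x :+ con (+ 1)) :- con (+ 1) := x) refl x
    -1+1 : ∀ x → (x - 1#) + 1# ≈ x
    -1+1 x = solve 1 (λ x → (x :- con (+ 1)) :+ con (+ 1) := x) refl x

  0∈es : 0# ∈ es
  0∈es = complete 0#

  units : List Carrier
  units = es ─ 0∈es

  q-1 : ℕ
  q-1 = length units

  q≡1+q-1 : q ≡ suc q-1
  q≡1+q-1 = length-removeAt′ es (Any.index 0∈es)

  units-nonZero : ∀ {x} → x ∈ units → NonZero x
  units-nonZero x∈ x≈0 = ─-excludes es 0∈es distinct x∈ (trans x≈0 (lookup-result 0∈es))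

  nonZero∈units : ∀ {x} → NonZero x → x ∈ units
  nonZero∈units {x} x≉0 with ─-split es 0∈es (complete x)
  ... | inj₁ x≈0 = contradiction (trans x≈0 (sym (lookup-result 0∈es))) x≉0
  ... | inj₂ x∈  = x∈

  q>0 : 0 < q
  q>0 = ≡.subst (0 <_) (≡.sym q≡1+q-1) (s≤s z≤n)

  q-1>0 : 0 < q-1
  q-1>0 with units | nonZero∈units 1≉0
  ... | _ ∷ _ | _ = s≤s z≤n

  product-scale : ∀ d xs → product (map (λ x → d * x) xs) ≈ pow d (length xs) * product (map (λ x → x) xs)
  product-scale d []       = sym (*-identityˡ 1#)
  product-scale d (x ∷ xs) = trans (*-congˡ (product-scale d xs))
    (solve 4 (λ d x a b → (d :* x) :* (a :* b) := (d :* a) :* (x :* b)) refl d x _ _)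

  product-nonZero : ∀ xs → (∀ {x} → x ∈ xs → NonZero x) → NonZero (product (map (λ x → x) xs))
  product-nonZero []       _       = 1≉0
  product-nonZero (x ∷ xs) xs≉0 = nonZero-* (xs≉0 (here refl)) (product-nonZero xs (λ x∈ → xs≉0 (there x∈)))

  -- Fermat's little theorem: multiplying by d permutes the nonzero elements,
  -- so their product Π satisfies Π = d^(q-1)·Π.
  fermat : ∀ {d} → NonZero d → pow d q-1 ≈ 1#
  fermat {d} d≉0 = *-cancelˡ Π (product-nonZero units units-nonZero) (begin
    Π * pow d q-1                          ≈⟨ *-comm _ _ ⟩
    pow d q-1 * Π                          ≈⟨ product-scale d units ⟨
    product (map (λ x → d * x) units)      ≈⟨ fold-reindex (λ x → x) (λ x≈y → x≈y) (d *_) (*-cancelˡ d d≉0)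
                                               units units (─-distinct es 0∈es distinct) (─-distinct es 0∈es distinct)
                                               (λ x∈ → nonZero∈units (nonZero-* d≉0 (units-nonZero x∈))) onto ⟩
    Π                                      ≈⟨ *-identityʳ Π ⟨
    Π * 1#                                 ∎)
    where
    Π : Carrier
    Π = product (map (λ x → x) units)
    onto : ∀ {y} → y ∈ units → Any (λ x → d * x ≈ y) units
    onto {y} y∈ = Any.map (λ d⁻¹y≈x → trans (*-congˡ (sym d⁻¹y≈x)) (x*[x⁻¹*y]≈y d≉0 y))
                          (nonZero∈units (nonZero-* (nonZero-inverse d≉0) (units-nonZero y∈)))

  pow-q : ∀ x → pow x q ≈ x
  pow-q x with x ≟ 0#
  ... | yes x≈0 = trans (pow-cong q x≈0) (trans (pow-0# q>0) (sym x≈0))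
  ... | no x≉0  = trans (pow-congʳ x q≡1+q-1) (trans (*-congˡ (fermat x≉0)) (*-identityʳ x))

  pow-multiple-of-q-1 : ∀ {d} → NonZero d → ∀ w → pow d (w ℕ.* q-1) ≈ 1#
  pow-multiple-of-q-1 {d} d≉0 w = begin
    pow d (w ℕ.* q-1)    ≡⟨ ≡.cong (pow d) (ℕₚ.*-comm w q-1) ⟩
    pow d (q-1 ℕ.* w)    ≈⟨ pow-* d q-1 w ⟩
    pow (pow d q-1) w    ≈⟨ pow-cong w (fermat d≉0) ⟩
    pow 1# w             ≈⟨ pow-1# w ⟩
    1#                   ∎

  powerSum : ℕ → Carrier
  powerSum l = sumL (map (λ c → pow c l) es)

  powerSum-0 : powerSum 0 ≈ 0#
  powerSum-0 = trans (sumL-1# es) q·1≈0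

  -- c ↦ d·c permutes F, so P(l) = d^l · P(l)
  powerSum-scale : ∀ {d} → NonZero d → ∀ l → powerSum l ≈ pow d l * powerSum l
  powerSum-scale {d} d≉0 l = begin
    powerSum l                              ≈⟨ sum-permute (λ c → pow c l) (pow-cong l) (d *_) ((d ⁻¹) *_)
                                                 *-congˡ *-congˡ (x⁻¹*[x*y]≈y d≉0) (x*[x⁻¹*y]≈y d≉0) ⟨
    sumL (map (λ c → pow (d * c) l) es)     ≈⟨ sumL-cong es (λ c → pow-distrib-* d c l) ⟩
    sumL (map (λ c → pow d l * pow c l) es) ≈⟨ sumL-*ˡ es (pow d l) (λ c → pow c l) ⟨
    pow d l * powerSum l                    ∎

  -- No exponent 0 < u < q - 1 satisfies d^u = 1 for all d ≠ 0: otherwise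
  -- x·(x^u - 1), of degree u + 1 < q, would vanish on all of F.
  no-small-exponent : ∀ u → 0 < u → u < q-1 → (∀ {d} → NonZero d → pow d u ≈ 1#) → ⊥
  no-small-exponent (suc v) _ u<q-1 d^u≈1 =
    root-bound (suc (suc v)) 1# f 1≉0 f-isPolynomial es distinct enough-points (all-roots es)
    where
    f : Carrier → Carrier
    f x = x * (pow x (suc v) - 1#)
    f-isPolynomial : IsPolynomial (suc (suc v)) 1# f
    f-isPolynomial = 0# , _ , (- 1# , (λ x → pow x v) , pow-isPolynomial v , λ x → +-comm _ _) ,
                     λ x → sym (+-identityˡ _)
    enough-points : suc (suc (suc v)) ≤ length es
    enough-points = ≡.subst (suc (suc (suc v)) ≤_) (≡.sym q≡1+q-1) (s≤s u<q-1)
    root : ∀ x → f x ≈ 0#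
    root x with x ≟ 0#
    ... | yes x≈0 = trans (*-congʳ x≈0) (zeroˡ _)
    ... | no x≉0  = trans (*-congˡ (trans (+-congʳ (d^u≈1 x≉0)) (-‿inverseʳ 1#))) (zeroʳ _)
    all-roots : ∀ xs → All (λ x → f x ≈ 0#) xs
    all-roots []       = []
    all-roots (x ∷ xs) = root x ∷ all-roots xs

  -- P(l) = 0 unless q - 1 divides l: if P(l) ≠ 0 then d^l = 1 for every
  -- d ≠ 0, hence also d^(l mod (q-1)) = 1, contradicting no-small-exponent.
  powerSum-vanishes : ∀ l → ¬ (q-1 ∣ l) → powerSum l ≈ 0#
  powerSum-vanishes l q-1∤l with powerSum l ≟ 0#
  ... | yes P≈0 = P≈0
  ... | no P≉0  = ⊥-elim (no-small-exponent u u>0 (m%n<n l q-1) d^u≈1)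
    where
    instance
      q-1≢0 : ℕ.NonZero q-1
      q-1≢0 = ℕ.>-nonZero q-1>0
    u : ℕ
    u = l % q-1
    u>0 : 0 < u
    u>0 with l % q-1 in eq
    ... | zero  = contradiction (m%n≡0⇒n∣m l q-1 eq) q-1∤l
    ... | suc _ = s≤s z≤n
    d^l≈1 : ∀ {d} → NonZero d → pow d l ≈ 1#
    d^l≈1 {d} d≉0 = *-cancelˡ (powerSum l) P≉0
      (trans (*-comm _ _) (trans (sym (powerSum-scale d≉0 l)) (sym (*-identityʳ _))))
    d^u≈1 : ∀ {d} → NonZero d → pow d u ≈ 1#
    d^u≈1 {d} d≉0 = begin
      pow d u                                ≈⟨ *-identityʳ _ ⟨
      pow d u * 1#                           ≈⟨ *-congˡ (pow-multiple-of-q-1 d≉0 (l / q-1)) ⟨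
      pow d u * pow d ((l / q-1) ℕ.* q-1)    ≈⟨ pow-+ d u _ ⟨
      pow d (u ℕ.+ (l / q-1) ℕ.* q-1)        ≡⟨ ≡.cong (pow d) (m≡m%n+[m/n]*n l q-1) ⟨
      pow d l                                ≈⟨ d^l≈1 d≉0 ⟩
      1#                                     ∎

  -- P(l) = -1 for positive multiples l of q - 1: every nonzero c^l is 1.
  powerSum-multiple : ∀ l → 0 < l → q-1 ∣ l → powerSum l ≈ - 1#
  powerSum-multiple l@(suc _) _ (divides w l≡w·q-1) = begin
    powerSum l                                            ≈⟨ sumL-cong es (λ c → solve 1 (λ a → a := (a :- con (+ 1)) :+ con (+ 1)) refl (pow c l)) ⟩
    sumL (map (λ c → g c + 1#) es)                        ≈⟨ sumL-+ es g (λ _ → 1#) ⟩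
    sumL (map g es) + sumL (map (λ _ → 1#) es)            ≈⟨ +-cong (sum-single g g-cong 0# vanish) (trans (sumL-1# es) q·1≈0) ⟩
    g 0# + 0#                                             ≈⟨ +-identityʳ _ ⟩
    pow 0# l - 1#                                         ≈⟨ +-congʳ (pow-0# {l} (s≤s z≤n)) ⟩
    0# - 1#                                               ≈⟨ +-identityˡ _ ⟩
    - 1#                                                  ∎
    where
    g : Carrier → Carrier
    g c = pow c l - 1#
    g-cong : ∀ {x y} → x ≈ y → g x ≈ g y
    g-cong x≈y = +-congʳ (pow-cong l x≈y)
    vanish : ∀ c → ¬ c ≈ 0# → g c ≈ 0#
    vanish c c≉0 = trans (+-congʳ (trans (pow-congʳ c l≡w·q-1) (pow-multiple-of-q-1 c≉0 w))) (-‿inverseʳ 1#)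

open import Algebra.Morphism.Structures using (module RingMorphisms)
import Data.Nat as ℕ
open import Data.Nat using (ℕ; _∸_; _^_; _≤_; _<_)
open import Data.Nat.Divisibility using (_∣_)
open import Data.Nat.Primality using (Prime)
open import Data.Nat.Combinatorics using (_C_)
open import Data.List using (length; map)
open import Data.Product using (_×_)
open import Relation.Binary.PropositionalEquality using (_≡_)

module Setting
  (p s : ℕ) (p-prime : Prime p) (s≥1 : 1 ≤ s)
  (F : Field) (es : List (Field.Carrier F)) (enum : Enumerates F es) (|F|≡p^s : length es ≡ p ^ s)
  (K : Field) (ι : Field.Carrier F → Field.Carrier K)
  (ι-hom : RingMorphisms.IsRingHomomorphism
             (CommutativeRing.rawRing (Field.commRing F)) (CommutativeRing.rawRing (Field.commRing K)) ι)
  (t : Field.Carrier K) (t-transcendental : Transcendental F K ι t)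
  where
  open import Data.Nat using (zero; suc; z≤n; s≤s)
  import Data.Nat.Properties as ℕₚ
  open import Data.Integer using (+_)
  open import Data.List using ([]; _∷_)
  open import Data.List.Relation.Unary.Any using (here; there)
  open import Data.Nat.Divisibility using (divides)
  open import Data.Nat.Coprimality using (Coprime)
  open import Data.Product using (proj₁; proj₂)
  open import Data.Nat.Primality using (prime⇒nonZero)
  open import Data.Empty using (⊥-elim)
  open import Relation.Nullary using (¬_; yes; no)
  open import Relation.Binary.PropositionalEquality as ≡ using (_≢_)

  open NatFacts
  module Fq = FiniteField F es enum
  open FieldFacts K
  open Frobenius K
  open RingMorphisms.IsRingHomomorphism ι-hom using (⟦⟧-cong; +-homo; *-homo; -‿homo; 0#-homo; 1#-homo)

  q Q : ℕ
  q = p ^ s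
  Q = q ∸ 1

  ι-pow : ∀ c l → ι (Fq.pow c l) ≈ pow (ι c) l
  ι-pow c zero    = 1#-homo
  ι-pow c (suc l) = trans (*-homo _ _) (*-congˡ (ι-pow c l))

  ι-sumL : ∀ {A : Set} (xs : List A) (g : A → Fq.Carrier) → ι (Fq.sumL (map g xs)) ≈ sumL (map (λ x → ι (g x)) xs)
  ι-sumL []       g = 0#-homo
  ι-sumL (x ∷ xs) g = trans (+-homo _ _) (+-congˡ (ι-sumL xs g))

  ι-fromℕ : ∀ n → ι (Fq.fromℕ n) ≈ fromℕ n
  ι-fromℕ zero    = 0#-homo
  ι-fromℕ (suc n) = trans (+-homo _ _) (+-cong 1#-homo (ι-fromℕ n))

  ι-0 : ∀ {c} → c Fq.≈ Fq.0# → ι c ≈ 0#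
  ι-0 c≈0 = trans (⟦⟧-cong c≈0) 0#-homo

  -- F and K have characteristic p: p^s·1 = q·1 = 0 in F, and F has no zero divisors.
  char-F : Fq.fromℕ p Fq.≈ Fq.0#
  char-F with Fq.fromℕ p Fq.≟ Fq.0#
  ... | yes p≈0 = p≈0
  ... | no  p≉0 = ⊥-elim (Fq.nonZero-pow s p≉0 (Fq.trans (Fq.sym (Fq.fromℕ-^ p s))
                    (Fq.trans (Fq.reflexive (≡.cong Fq.fromℕ (≡.sym |F|≡p^s))) Fq.q·1≈0)))

  char-K : fromℕ p ≈ 0#
  char-K = trans (sym (ι-fromℕ p)) (ι-0 char-F)

  q-1≡Q : Fq.q-1 ≡ Q
  q-1≡Q = ≡.trans (≡.cong ℕ.pred (≡.trans (≡.sym Fq.q≡1+q-1) |F|≡p^s)) (ℕₚ.pred[m∸n]≡m∸[1+n] q 0)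

  q≡1+Q : q ≡ suc Q
  q≡1+Q = ≡.trans (≡.sym |F|≡p^s) (≡.trans Fq.q≡1+q-1 (≡.cong suc q-1≡Q))

  Q′ : ℕ
  Q′ = ℕ.pred Q

  Q≡1+Q′ : Q ≡ suc Q′
  Q≡1+Q′ with Q | ≡.subst (0 <_) q-1≡Q Fq.q-1>0
  ... | suc _ | _ = ≡.refl

  -- (-1)^(q-1) = 1, since (-1)^q = -1
  pow-minus-one-Q : pow (- 1#) Q ≈ 1#
  pow-minus-one-Q = *-cancelˡ (- 1#) -1≉0 (begin
    - 1# * pow (- 1#) Q   ≈⟨ pow-congʳ (- 1#) q≡1+Q ⟨
    pow (- 1#) q          ≈⟨ pow-minus-one p-prime char-K s ⟩
    - 1#                  ≈⟨ *-identityʳ _ ⟨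
    - 1# * 1#             ∎)

  -- t + ι c ≠ 0, since t is not a root of the polynomial X + c.
  t+ι≉0 : ∀ c → NonZero (t + ι c)
  t+ι≉0 c t+ιc≈0 = t-transcendental (c ∷ Fq.1# ∷ []) (there (here Fq.1≉0)) (trans eval≈ t+ιc≈0)
    where
    eval≈ : ι c + t * (ι Fq.1# + t * 0#) ≈ t + ι c
    eval≈ = trans (+-congˡ (*-congˡ (trans (+-cong 1#-homo (zeroʳ t)) (+-identityʳ 1#))))
                  (trans (+-congˡ (*-identityʳ t)) (+-comm _ _))

  [1] : Carrier
  [1] = pow t q - t

  -- (t + c)^q = t^q + c for c ∈ F, by Frobenius and c^q = c
  pow-q-translate : ∀ c → pow (t + ι c) q ≈ pow t q + ι c
  pow-q-translate c = begin
    pow (t + ι c) q          ≈⟨ frobenius-^ p-prime char-K s t (ι c) ⟩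
    pow t q + pow (ι c) q    ≈⟨ +-congˡ (trans (sym (ι-pow c q)) (⟦⟧-cong (Fq.trans (Fq.pow-congʳ c (≡.sym |F|≡p^s)) (Fq.pow-q c)))) ⟩
    pow t q + ι c            ∎

  -- hence [1] = (t + c)^q - (t + c) = y·(y^(q-1) - 1) for y = t + ι c
  bracket-factor : ∀ c → [1] ≈ (t + ι c) * (pow (t + ι c) Q - 1#)
  bracket-factor c = begin
    pow t q - t                   ≈⟨ solve 3 (λ T t c → T :- t := (T :+ c) :- (t :+ c)) refl (pow t q) t (ι c) ⟩
    (pow t q + ι c) - y           ≈⟨ +-congʳ (pow-q-translate c) ⟨
    pow y q - y                   ≈⟨ +-congʳ (pow-congʳ y q≡1+Q) ⟩
    y * pow y Q - y               ≈⟨ solve 2 (λ y Y → y :* Y :- y := y :* (Y :- con (+ 1))) refl y (pow y Q) ⟩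
    y * (pow y Q - 1#)            ∎
    where
    y : Carrier
    y = t + ι c

  module Exponents (a m : ℕ) (a≥1 : 1 ≤ a) (a≤N : a ≤ p ^ m) where
    N e r : ℕ
    N = p ^ m
    e = N ∸ a
    r = Q ℕ.* N

    e+a≡N : e ℕ.+ a ≡ N
    e+a≡N = ℕₚ.m∸n+n≡m a≤N

    N>0 : 0 < N
    N>0 = ℕₚ.m^n>0 p {{prime⇒nonZero p-prime}} m

    e<N : e < N
    e<N = ℕₚ.∸-monoʳ-< a≥1 a≤N

    r>0 : 0 < r
    r>0 = ≡.subst (λ k → 0 < k ℕ.* N) (≡.sym Q≡1+Q′) (ℕₚ.≤-trans N>0 (ℕₚ.m≤m+n N (Q′ ℕ.* N)))

    -- (-1)^k = (-1)^j whenever q - 1 ∣ j + kN, since (-1)^N = -1 and (-1)^(q-1) = 1.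
    sign-parity : ∀ j k → Q ∣ j ℕ.+ k ℕ.* N → pow (- 1#) k ≈ pow (- 1#) j
    sign-parity j k (divides w j+kN≡wQ) = *-cancelˡ (pow (- 1#) j) (nonZero-pow j -1≉0) (begin
      pow (- 1#) j * pow (- 1#) k                ≈⟨ *-congˡ (pow-cong k (pow-minus-one p-prime char-K m)) ⟨
      pow (- 1#) j * pow (pow (- 1#) N) k        ≈⟨ *-congˡ (pow-* (- 1#) N k) ⟨
      pow (- 1#) j * pow (- 1#) (N ℕ.* k)        ≈⟨ pow-+ (- 1#) j (N ℕ.* k) ⟨
      pow (- 1#) (j ℕ.+ N ℕ.* k)                 ≡⟨ ≡.cong (pow (- 1#)) (≡.trans (≡.cong (j ℕ.+_) (ℕₚ.*-comm N k))
                                                      (≡.trans j+kN≡wQ (ℕₚ.*-comm w Q))) ⟩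
      pow (- 1#) (Q ℕ.* w)                       ≈⟨ pow-* (- 1#) Q w ⟩
      pow (pow (- 1#) Q) w                       ≈⟨ trans (pow-cong w pow-minus-one-Q) (pow-1# w) ⟩
      1#                                         ≈⟨ pow-1# j ⟨
      pow 1# j                                   ≈⟨ pow-cong j (trans (-1*x≈-x (- 1#)) (-‿involutive 1#)) ⟨
      pow (- 1# * - 1#) j                        ≈⟨ pow-distrib-* (- 1#) (- 1#) j ⟩
      pow (- 1#) j * pow (- 1#) j                ∎)

    φ : Carrier → Carrier
    φ y = pow y e * (pow y r - 1#)

    φ-cong : ∀ {x y} → x ≈ y → φ x ≈ φ y
    φ-cong x≈y = *-cong (pow-cong e x≈y) (+-congʳ (pow-cong r x≈y))

    -- [1]^N / y^a = φ(y) for y = t + ι c: raise the factorisation of [1]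
    -- to the power N = p^m using the Frobenius map.
    bracket-power : ∀ c → pow [1] N * (pow (t + ι c) a) ⁻¹ ≈ φ (t + ι c)
    bracket-power c = begin
      pow [1] N * y⁻ᵃ                                ≈⟨ *-congʳ (pow-cong N (bracket-factor c)) ⟩
      pow (y * (pow y Q - 1#)) N * y⁻ᵃ               ≈⟨ *-congʳ (pow-distrib-* y _ N) ⟩
      pow y N * pow (pow y Q - 1#) N * y⁻ᵃ           ≈⟨ *-congʳ (*-congˡ (frobenius-^-sub p-prime char-K m (pow y Q) 1#)) ⟩
      pow y N * (pow (pow y Q) N - pow 1# N) * y⁻ᵃ   ≈⟨ *-congʳ (*-congˡ (+-cong (sym (pow-* y Q N)) (-‿cong (pow-1# N)))) ⟩
      pow y N * (pow y r - 1#) * y⁻ᵃ                 ≈⟨ *-congʳ (*-congʳ (trans (pow-congʳ y (≡.sym e+a≡N)) (pow-+ y e a))) ⟩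
      pow y e * pow y a * (pow y r - 1#) * y⁻ᵃ       ≈⟨ solve 4 (λ E A R I → E :* A :* R :* I := E :* R :* (A :* I)) refl (pow y e) (pow y a) _ _ ⟩
      φ y * (pow y a * y⁻ᵃ)                          ≈⟨ *-congˡ (inverseʳ _ (nonZero-pow a (t+ι≉0 c))) ⟩
      φ y * 1#                                       ≈⟨ *-identityʳ _ ⟩
      φ y                                            ∎
      where
      y y⁻ᵃ : Carrier
      y = t + ι c
      y⁻ᵃ = (pow y a) ⁻¹

    collect-bracket : ∀ x y → pow [1] e * x * pow [1] a * y ≈ x * (pow [1] N * y)
    collect-bracket x y = begin
      pow [1] e * x * pow [1] a * y      ≈⟨ solve 4 (λ E x A y → E :* x :* A :* y := x :* ((E :* A) :* y)) refl _ _ _ _ ⟩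
      x * ((pow [1] e * pow [1] a) * y)  ≈⟨ *-congˡ (*-congʳ (trans (sym (pow-+ [1] e a)) (pow-congʳ [1] e+a≡N))) ⟩
      x * (pow [1] N * y)                ∎

    S₁ : Carrier
    S₁ = sumL (map (λ c → (pow (t + ι c) a) ⁻¹) es)

    bracket-sum : pow [1] N * S₁ ≈ sumL (map (λ c → φ (t + ι c)) es)
    bracket-sum = trans (sumL-*ˡ es (pow [1] N) _) (sumL-cong es bracket-power)

    -- Centre everything at n = t + ι θ: write c = θ + γ.
    module Centred (θ : Fq.Carrier) where
      n Y : Carrier
      n = t + ι θ
      Y = pow n N

      -- Σ_c φ(t + ι c) = Σ_γ φ(n + ι γ), by the permutation γ ↦ θ + γ of F
      recentre : sumL (map (λ c → φ (t + ι c)) es) ≈ sumL (map (λ γ → φ (n + ι γ)) es)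
      recentre = begin
        sumL (map (λ c → φ (t + ι c)) es)              ≈⟨ sum-permute (λ c → φ (t + ι c)) (λ c≈d → φ-cong (+-congˡ (⟦⟧-cong c≈d)))
                                                            (θ Fq.+_) (Fq._- θ) Fq.+-congˡ Fq.+-congʳ θ+γ-θ θ+[c-θ] ⟨
        sumL (map (λ γ → φ (t + ι (θ Fq.+ γ))) es)     ≈⟨ sumL-cong es (λ γ → φ-cong (trans (+-congˡ (+-homo θ γ)) (sym (+-assoc t _ _)))) ⟩
        sumL (map (λ γ → φ (n + ι γ)) es)              ∎
        where
        open Fq.FieldSumsOverF K using (sum-permute)
        θ+γ-θ : ∀ γ → (θ Fq.+ γ) Fq.- θ Fq.≈ γ
        θ+γ-θ γ = Fq.solve 2 (λ θ γ → (θ Fq.:+ γ) Fq.:- θ Fq.:= γ) Fq.refl θ γ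
        θ+[c-θ] : ∀ c → θ Fq.+ (c Fq.- θ) Fq.≈ c
        θ+[c-θ] c = Fq.solve 2 (λ θ c → θ Fq.:+ (c Fq.:- θ) Fq.:= c) Fq.refl θ c

      A B : ℕ → Carrier
      A j = fromℕ (e C j) * pow n (e ∸ j)
      B k = pow (- 1#) k * pow Y (Q ∸ k)

      -- (n + z)^r - 1 = Σ_{k < q-1} B_k z^(kN) + (z^r - 1): apply Frobenius to
      -- (n + z)^N = Y + z^N and expand (Y + z^N)^(q-1) as a geometric sum.
      pow-r-expansion : ∀ z → NonZero (n + z) →
        pow (n + z) r - 1# ≈ Σ₀ Q′ (λ k → B k * pow z (k ℕ.* N)) + (pow z r - 1#)
      pow-r-expansion z n+z≉0 = begin
        pow (n + z) r - 1#                ≡⟨ ≡.cong (λ k → pow (n + z) k - 1#) (ℕₚ.*-comm Q N) ⟩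
        pow (n + z) (N ℕ.* Q) - 1#        ≈⟨ +-congʳ (pow-* (n + z) N Q) ⟩
        pow (pow (n + z) N) Q - 1#        ≈⟨ +-congʳ (pow-cong Q (frobenius-^ p-prime char-K m n z)) ⟩
        pow (Y + Z) Q - 1#                ≈⟨ +-congʳ (pow-pred-expansion p-prime char-K s Q q≡1+Q Y Z Y+Z≉0) ⟩
        Σ₀ Q G - 1#                       ≈⟨ +-congʳ (Σ₀-last G Q≡1+Q′) ⟩
        (Σ₀ Q′ G + G Q) - 1#              ≈⟨ +-assoc _ _ _ ⟩
        Σ₀ Q′ G + (G Q - 1#)              ≈⟨ +-cong (Σ₀-cong Q′ (λ k _ → G≈ k)) (+-congʳ G-top) ⟩
        Σ₀ Q′ (λ k → B k * pow z (k ℕ.* N)) + (pow z r - 1#) ∎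
        where
        Z : Carrier
        Z = pow z N
        G : ℕ → Carrier
        G k = pow Y (Q ∸ k) * pow (- Z) k
        Y+Z≉0 : NonZero (Y + Z)
        Y+Z≉0 Y+Z≈0 = nonZero-pow N n+z≉0 (trans (frobenius-^ p-prime char-K m n z) Y+Z≈0)
        Z^k : ∀ k → pow Z k ≈ pow z (k ℕ.* N)
        Z^k k = trans (sym (pow-* z N k)) (pow-congʳ z (ℕₚ.*-comm N k))
        G≈ : ∀ k → G k ≈ B k * pow z (k ℕ.* N)
        G≈ k = begin
          pow Y (Q ∸ k) * pow (- Z) k                ≈⟨ *-congˡ (pow-neg Z k) ⟩
          pow Y (Q ∸ k) * (pow (- 1#) k * pow Z k)   ≈⟨ solve 3 (λ a b c → a :* (b :* c) := (b :* a) :* c) refl _ _ _ ⟩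
          B k * pow Z k                              ≈⟨ *-congˡ (Z^k k) ⟩
          B k * pow z (k ℕ.* N)                      ∎
        G-top : G Q ≈ pow z r
        G-top = begin
          pow Y (Q ∸ Q) * pow (- Z) Q   ≈⟨ *-congʳ (pow-congʳ Y (ℕₚ.n∸n≡0 Q)) ⟩
          1# * pow (- Z) Q              ≈⟨ *-identityˡ _ ⟩
          pow (- Z) Q                   ≈⟨ pow-neg Z Q ⟩
          pow (- 1#) Q * pow Z Q        ≈⟨ *-congʳ pow-minus-one-Q ⟩
          1# * pow Z Q                  ≈⟨ *-identityˡ _ ⟩
          pow Z Q                       ≈⟨ Z^k Q ⟩
          pow z r                       ∎

      -- Multiplying by the binomial expansion of (n + z)^e.
      expansion : ∀ z → NonZero (n + z) →
        φ (n + z) ≈ Σ₀ e (λ j → Σ₀ Q′ (λ k → (A j * B k) * pow z (j ℕ.+ k ℕ.* N)))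
                    + pow (n + z) e * (pow z r - 1#)
      expansion z n+z≉0 = begin
        pow (n + z) e * (pow (n + z) r - 1#)                    ≈⟨ *-congˡ (pow-r-expansion z n+z≉0) ⟩
        pow (n + z) e * (Σ₀ Q′ Bz + R₀)                          ≈⟨ distribˡ _ _ _ ⟩
        pow (n + z) e * Σ₀ Q′ Bz + pow (n + z) e * R₀            ≈⟨ +-congʳ (*-congʳ binomial-n+z) ⟩
        Σ₀ e Az * Σ₀ Q′ Bz + pow (n + z) e * R₀                  ≈⟨ +-congʳ (Σ₀-product e Q′ Az Bz) ⟩
        Σ₀ e (λ j → Σ₀ Q′ (λ k → Az j * Bz k)) + pow (n + z) e * R₀
          ≈⟨ +-congʳ (Σ₀-cong e (λ j _ → Σ₀-cong Q′ (λ k _ → regroup j k))) ⟩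
        Σ₀ e (λ j → Σ₀ Q′ (λ k → (A j * B k) * pow z (j ℕ.+ k ℕ.* N))) + pow (n + z) e * R₀ ∎
        where
        Az Bz : ℕ → Carrier
        Az j = A j * pow z j
        Bz k = B k * pow z (k ℕ.* N)
        R₀ : Carrier
        R₀ = pow z r - 1#
        binomial-n+z : pow (n + z) e ≈ Σ₀ e Az
        binomial-n+z = trans (binomial e n z) (Σ₀-cong e (λ j _ → sym (*-assoc _ _ _)))
        regroup : ∀ j k → Az j * Bz k ≈ (A j * B k) * pow z (j ℕ.+ k ℕ.* N)
        regroup j k = trans (solve 4 (λ a b c d → a :* b :* (c :* d) := (a :* c) :* (b :* d)) refl _ _ _ _)
                            (*-congˡ (sym (pow-+ z j (k ℕ.* N))))

      n+ι≉0 : ∀ γ → NonZero (n + ι γ)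
      n+ι≉0 γ n+ιγ≈0 = t+ι≉0 (θ Fq.+ γ) (trans (+-congˡ (+-homo θ γ)) (trans (sym (+-assoc t _ _)) n+ιγ≈0))

      powerSum-in-K : ∀ l → sumL (map (λ γ → pow (ι γ) l) es) ≈ ι (Fq.powerSum l)
      powerSum-in-K l = trans (sumL-cong es (λ γ → sym (ι-pow γ l))) (sym (ι-sumL es (λ γ → Fq.pow γ l)))

      -- In Σ_γ (n + ιγ)^e ((ιγ)^r - 1) only γ = 0 contributes, as γ^r = 1 for γ ≠ 0.
      boundary-sum : sumL (map (λ γ → pow (n + ι γ) e * (pow (ι γ) r - 1#)) es) ≈ - pow n e
      boundary-sum = begin
        sumL (map g es)                  ≈⟨ sum-single g g-cong Fq.0# vanish ⟩
        g Fq.0#                          ≈⟨ *-cong (pow-cong e (trans (+-congˡ 0#-homo) (+-identityʳ n)))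
                                                   (+-congʳ (trans (pow-cong r 0#-homo) (pow-0# r>0))) ⟩
        pow n e * (0# - 1#)              ≈⟨ solve 1 (λ x → x :* (con (+ 0) :- con (+ 1)) := :- x) refl _ ⟩
        - pow n e                        ∎
        where
        open Fq.FieldSumsOverF K using (sum-single)
        g : Fq.Carrier → Carrier
        g γ = pow (n + ι γ) e * (pow (ι γ) r - 1#)
        g-cong : ∀ {γ δ} → γ Fq.≈ δ → g γ ≈ g δ
        g-cong γ≈δ = *-cong (pow-cong e (+-congˡ (⟦⟧-cong γ≈δ))) (+-congʳ (pow-cong r (⟦⟧-cong γ≈δ)))
        vanish : ∀ γ → Fq.NonZero γ → g γ ≈ 0#
        vanish γ γ≉0 = trans (*-congˡ (trans (+-congʳ ιγ^r≈1) (-‿inverseʳ 1#))) (zeroʳ _)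
          where
          r≡N·q-1 : r ≡ N ℕ.* Fq.q-1
          r≡N·q-1 = ≡.trans (ℕₚ.*-comm Q N) (≡.cong (N ℕ.*_) (≡.sym q-1≡Q))
          ιγ^r≈1 : pow (ι γ) r ≈ 1#
          ιγ^r≈1 = begin
            pow (ι γ) r                      ≈⟨ ι-pow γ r ⟨
            ι (Fq.pow γ r)                   ≈⟨ ⟦⟧-cong (Fq.trans (Fq.pow-congʳ γ r≡N·q-1) (Fq.pow-multiple-of-q-1 γ≉0 N)) ⟩
            ι Fq.1#                          ≈⟨ 1#-homo ⟩
            1#                               ∎

      sum-expansion : sumL (map (λ γ → φ (n + ι γ)) es)
        ≈ Σ₀ e (λ j → Σ₀ Q′ (λ k → (A j * B k) * ι (Fq.powerSum (j ℕ.+ k ℕ.* N)))) + - pow n e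
      sum-expansion = begin
        sumL (map (λ γ → φ (n + ι γ)) es)     ≈⟨ sumL-cong es (λ γ → expansion (ι γ) (n+ι≉0 γ)) ⟩
        sumL (map (λ γ → D γ + E γ) es)       ≈⟨ sumL-+ es D E ⟩
        sumL (map D es) + sumL (map E es)     ≈⟨ +-cong D-sum boundary-sum ⟩
        Σ₀ e (λ j → Σ₀ Q′ (λ k → (A j * B k) * ι (Fq.powerSum (j ℕ.+ k ℕ.* N)))) + - pow n e ∎
        where
        D E : Fq.Carrier → Carrier
        D γ = Σ₀ e (λ j → Σ₀ Q′ (λ k → (A j * B k) * pow (ι γ) (j ℕ.+ k ℕ.* N)))
        E γ = pow (n + ι γ) e * (pow (ι γ) r - 1#)
        D-sum : sumL (map D es) ≈ Σ₀ e (λ j → Σ₀ Q′ (λ k → (A j * B k) * ι (Fq.powerSum (j ℕ.+ k ℕ.* N))))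
        D-sum = begin
          sumL (map D es)
            ≈⟨ sumL-Σ₀ es e _ ⟩
          Σ₀ e (λ j → sumL (map (λ γ → Σ₀ Q′ (λ k → (A j * B k) * pow (ι γ) (j ℕ.+ k ℕ.* N))) es))
            ≈⟨ Σ₀-cong e (λ j _ → sumL-Σ₀ es Q′ _) ⟩
          Σ₀ e (λ j → Σ₀ Q′ (λ k → sumL (map (λ γ → (A j * B k) * pow (ι γ) (j ℕ.+ k ℕ.* N)) es)))
            ≈⟨ Σ₀-cong e (λ j _ → Σ₀-cong Q′ (λ k _ →
                 trans (sym (sumL-*ˡ es _ _)) (*-congˡ (powerSum-in-K (j ℕ.+ k ℕ.* N))))) ⟩
          Σ₀ e (λ j → Σ₀ Q′ (λ k → (A j * B k) * ι (Fq.powerSum (j ℕ.+ k ℕ.* N)))) ∎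

      module Coefficients (i : ℕ → ℕ) (i-spec : ∀ j → j ≤ e → (i j < Q) × (Q ∣ (j ℕ.+ i j ℕ.* N))) where

        -- the value of the inner sum over k (zero for j = 0)
        W : ℕ → Carrier
        W zero    = 0#
        W (suc j) = - (A (suc j) * B (i (suc j)))

        Q-coprime-p : Coprime Q p
        Q-coprime-p = pred-power-coprime p s s≥1 (≡.subst (0 <_) (≡.sym q≡1+Q) (s≤s z≤n))

        -- The surviving term k = i_j: P(0) = 0, and P(l) = -1 for 0 < l divisible by q - 1.
        surviving-term : ∀ j → j ≤ e → (A j * B (i j)) * ι (Fq.powerSum (j ℕ.+ i j ℕ.* N)) ≈ W j
        surviving-term zero _ = trans (*-congˡ (ι-0 P≈0)) (zeroʳ _)
          where
          i₀≡0 : i 0 ≡ 0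
          i₀≡0 = ≡.sym (exponent-unique Q-coprime-p m 0 (≡.subst (0 <_) (≡.sym Q≡1+Q′) (s≤s z≤n))
                          (proj₁ (i-spec 0 z≤n)) (divides 0 ≡.refl) (proj₂ (i-spec 0 z≤n)))
          P≈0 : Fq.powerSum (i 0 ℕ.* N) Fq.≈ Fq.0#
          P≈0 = Fq.trans (Fq.reflexive (≡.cong (λ k → Fq.powerSum (k ℕ.* N)) i₀≡0)) Fq.powerSum-0
        surviving-term j@(suc _) j≤e = begin
          (A j * B (i j)) * ι (Fq.powerSum l)   ≈⟨ *-congˡ (⟦⟧-cong (Fq.powerSum-multiple l (s≤s z≤n) q-1∣l)) ⟩
          (A j * B (i j)) * ι (Fq.- Fq.1#)      ≈⟨ *-congˡ (trans (-‿homo Fq.1#) (-‿cong 1#-homo)) ⟩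
          (A j * B (i j)) * - 1#                ≈⟨ trans (*-comm _ _) (-1*x≈-x _) ⟩
          W j                                   ∎
          where
          l : ℕ
          l = j ℕ.+ i j ℕ.* N
          q-1∣l : Fq.q-1 ∣ l
          q-1∣l = ≡.subst (_∣ l) (≡.sym q-1≡Q) (proj₂ (i-spec j j≤e))

        -- In Σ_k A_j B_k P(j + kN) only k = i_j survives: P(l) vanishes
        -- unless q - 1 ∣ l, and i_j is the only k < q - 1 with q - 1 ∣ j + kN.
        inner-sum : ∀ j → j ≤ e → Σ₀ Q′ (λ k → (A j * B k) * ι (Fq.powerSum (j ℕ.+ k ℕ.* N))) ≈ W j
        inner-sum j j≤e = trans (Σ₀-single Q′ V (i j) i≤Q′ others) (surviving-term j j≤e)
          where
          i<Q : i j < Q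
          i<Q = proj₁ (i-spec j j≤e)
          V : ℕ → Carrier
          V k = (A j * B k) * ι (Fq.powerSum (j ℕ.+ k ℕ.* N))
          i≤Q′ : i j ≤ Q′
          i≤Q′ = ℕₚ.≤-pred (≡.subst (i j <_) Q≡1+Q′ i<Q)
          others : ∀ k → k ≤ Q′ → k ≢ i j → V k ≈ 0#
          others k k≤Q′ k≢i = trans (*-congˡ (ι-0 (Fq.powerSum-vanishes _ q-1∤))) (zeroʳ _)
            where
            q-1∤ : ¬ (Fq.q-1 ∣ j ℕ.+ k ℕ.* N)
            q-1∤ q-1∣ = k≢i (exponent-unique Q-coprime-p m j (≡.subst (k <_) (≡.sym Q≡1+Q′) (s≤s k≤Q′)) i<Q
                              (≡.subst (_∣ j ℕ.+ k ℕ.* N) q-1≡Q q-1∣) (proj₂ (i-spec j j≤e)))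

        f h : ℕ → Carrier
        f j = pow (- 1#) j * fromℕ (e C j)
        h j = f j * pow n (r ∸ (j ℕ.+ i j ℕ.* N))

        -- W_j = -n^e·h_j: the sign (-1)^(i_j) is (-1)^j, and the exponents combine
        -- as (e - j) + N·(q-1-i_j) = e + (r - (j + i_j·N)).
        surviving-term≈ : ∀ j → 1 ≤ j → j ≤ e → W j ≈ - (pow n e * h j)
        surviving-term≈ j@(suc _) _ j≤e = -‿cong (begin
          (fromℕ (e C j) * pow n (e ∸ j)) * (pow (- 1#) (i j) * pow Y (Q ∸ i j))
            ≈⟨ *-congˡ (*-cong (sign-parity j (i j) Q∣) (sym (pow-* n N (Q ∸ i j)))) ⟩
          (fromℕ (e C j) * pow n (e ∸ j)) * (pow (- 1#) j * pow n (N ℕ.* (Q ∸ i j)))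
            ≈⟨ solve 4 (λ c a s b → (c :* a) :* (s :* b) := (s :* c) :* (a :* b)) refl _ _ _ _ ⟩
          f j * (pow n (e ∸ j) * pow n (N ℕ.* (Q ∸ i j)))
            ≈⟨ *-congˡ (pow-+ n (e ∸ j) _) ⟨
          f j * pow n ((e ∸ j) ℕ.+ N ℕ.* (Q ∸ i j))
            ≡⟨ ≡.cong (λ k → f j * pow n k) (exponent-shift e j N Q (i j) j≤e e<N i<Q) ⟩
          f j * pow n (e ℕ.+ (r ∸ (j ℕ.+ i j ℕ.* N)))
            ≈⟨ *-congˡ (pow-+ n e _) ⟩
          f j * (pow n e * pow n (r ∸ (j ℕ.+ i j ℕ.* N)))
            ≈⟨ solve 3 (λ f a b → f :* (a :* b) := a :* (f :* b)) refl _ _ _ ⟩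
          pow n e * h j ∎)
          where
          i<Q : i j < Q
          i<Q = proj₁ (i-spec j j≤e)
          Q∣ : Q ∣ j ℕ.+ i j ℕ.* N
          Q∣  = proj₂ (i-spec j j≤e)

        key-identity : sumL (map (λ γ → φ (n + ι γ)) es) ≈ - (pow n e * (1# + Σ₁ e h))
        key-identity = begin
          sumL (map (λ γ → φ (n + ι γ)) es)
            ≈⟨ sum-expansion ⟩
          Σ₀ e (λ j → Σ₀ Q′ (λ k → (A j * B k) * ι (Fq.powerSum (j ℕ.+ k ℕ.* N)))) + - pow n e
            ≈⟨ +-congʳ (Σ₀-cong e inner-sum) ⟩
          (0# + Σ₁ e W) + - pow n e
            ≈⟨ +-congʳ (trans (+-identityˡ _) (Σ₁-cong e surviving-term≈)) ⟩
          Σ₁ e (λ j → - (pow n e * h j)) + - pow n e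
            ≈⟨ +-congʳ (trans (sym (Σ₁-neg e _)) (-‿cong (sym (Σ₁-*ˡ e (pow n e) h)))) ⟩
          - (pow n e * Σ₁ e h) + - pow n e
            ≈⟨ solve 2 (λ x s → :- (x :* s) :+ :- x := :- (x :* (con (+ 1) :+ s))) refl _ _ ⟩
          - (pow n e * (1# + Σ₁ e h)) ∎

open import Data.Nat using (ℕ; _+_; _*_; _∸_; _^_; _≤_; _<_)
open import Data.Nat.Divisibility using (_∣_)
open import Data.Nat.Primality using (Prime)
open import Data.Nat.Combinatorics using (_C_)
open import Data.List using (List; length; map)
open import Data.Product using (_×_)
open import Relation.Binary.PropositionalEquality using (_≡_)

-- Proposition 5.10: g_n = -[1]^e·n^(-e)·[1]^a·S₁(a) equals -n^(-e)·[1]^N·S₁(a)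
-- = -n^(-e)·Σ_γ φ(n + ι γ) = -n^(-e)·(-n^e·(1 + Σ_j f_j n^(r - (j + i_j N)))).
proposition5p10 :
  (p s : ℕ) → Prime p → 1 ≤ s →
  (F : Field) → (enumF : List (Field.Carrier F)) → Enumerates F enumF → length enumF ≡ p ^ s →
  (K : Field) → (ι : Field.Carrier F → Field.Carrier K) →
  RingMorphisms.IsRingHomomorphism (CommutativeRing.rawRing (Field.commRing F)) (CommutativeRing.rawRing (Field.commRing K)) ι →
  (t : Field.Carrier K) → Transcendental F K ι t →
  (a : ℕ) → 1 ≤ a →
  (m : ℕ) → a ≤ p ^ m → (∀ k → k < m → p ^ k < a) →
  (i : ℕ → ℕ) →
  (∀ j → j ≤ p ^ m ∸ a → (i j < p ^ s ∸ 1) × ((p ^ s ∸ 1) ∣ (j + i j * p ^ m))) →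
  (θ : Field.Carrier F) →
  let open FieldOpsᴷ K
      q = p ^ s
      br = pow t q -ᴷ t
      n = t +ᴷ ι θ
      S₁a = sumL (map (λ θ′ → (pow (t +ᴷ ι θ′) a) ⁻¹) enumF)
      gₙ = -ᴷ (pow br (p ^ m ∸ a) *ᴷ (pow n (p ^ m ∸ a)) ⁻¹ *ᴷ pow br a *ᴷ S₁a)
      rₐ = (q ∸ 1) * p ^ m
      f = λ j → pow (-ᴷ 1#) j *ᴷ fromℕ ((p ^ m ∸ a) C j)
  in gₙ ≈ 1# +ᴷ Σ₁ (p ^ m ∸ a) (λ j → f j *ᴷ pow n (rₐ ∸ (j + i j * p ^ m)))
proposition5p10 p s p-prime s≥1 F es enum |F|≡p^s K ι ι-hom t t-transcendental a a≥1 m a≤p^m _ i i-spec θ =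
  K.begin
    -ᴷ (pow [1] e *ᴷ n⁻ᵉ *ᴷ pow [1] a *ᴷ S₁)        K.≈⟨ K.-‿cong (collect-bracket n⁻ᵉ S₁) ⟩
    -ᴷ (n⁻ᵉ *ᴷ (pow [1] N *ᴷ S₁))                  K.≈⟨ K.-‿cong (K.*-congˡ (K.trans bracket-sum recentre)) ⟩
    -ᴷ (n⁻ᵉ *ᴷ sumL (map (λ γ → φ (n +ᴷ ι γ)) es))  K.≈⟨ K.-‿cong (K.*-congˡ key-identity) ⟩
    -ᴷ (n⁻ᵉ *ᴷ -ᴷ (pow n e *ᴷ (1# +ᴷ Σ₁ e h)))      K.≈⟨ K.inverse-neg-cancel _ (K.nonZero-pow e (t+ι≉0 θ)) ⟩
    1# +ᴷ Σ₁ e h                                   K.∎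
  where
  open FieldOpsᴷ K using (_+ᴷ_; _*ᴷ_; -ᴷ_; 1#; pow; sumL; Σ₁; _⁻¹)
  module K = FieldFacts K
  open Setting p s p-prime s≥1 F es enum |F|≡p^s K ι ι-hom t t-transcendental
  open Exponents a m a≥1 a≤p^m
  open Centred θ
  open Coefficients i i-spec
  n⁻ᵉ : Field.Carrier K
  n⁻ᵉ = (pow n e) ⁻¹
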